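{- Let $\Sigma$ be a finite CW complex of dimension $d$ with $n$ facets, with cut lattice $\mathcal{C}=\operatorname{im}_{\mathbb{Z}}\partial_d^*\subseteq\mathbb{Z}^n$ and flow lattice $\mathcal{F}=\ker_{\mathbb{Z}}\partial_d\subseteq\mathbb{Z}^n$. Then there is a short exact sequence $$0\to\operatorname{tor}(\tilde H_{d-1}(\Sigma;\mathbb{Z}))\to\mathbb{Z}^n/(\mathcal{C}\oplus\mathcal{F})\to\mathcal{F}^\sharp/\mathcal{F}\to0.$$ Moreover, for every acyclization $\Omega$ of $\Sigma$, the cocritical group $K^*(\Sigma)$ defined using $\Omega$ is isomorphic to $\mathcal{F}^\sharp/\mathcal{F}$ (in particular it does not depend on the choice of $\Omega$).
   Context: $\Sigma$ is a finite CW complex with the convention that it has a unique cell of dimension $-1$ (so cellular homology is reduced homology $\tilde H_*$); $d$-cells are called facets. Cells are oriented, with cellular boundary maps $\partial_i$ and coboundary maps $\partial_i^*$ (transposes), and $C_d(\Sigma;\mathbb{Z})\cong\mathbb{Z}^n$ carries the standard inner product with facets orthonormal. For a lattice $\mathcal{L}\subseteq\mathbb{R}^n$, $\mathcal{L}^\sharp=\{v\in\mathcal{L}\otimes\mathbb{R}:\langle v,w\rangle\in\mathbb{Z}\ \forall w\in\mathcal{L}\}$; $\operatorname{tor}$ denotes torsion subgroup. An acyclization of $\Sigma$ is a $(d+1)$-dimensional CW complex $\Omega$ with $d$-skeleton $\Omega_{(d)}=\Sigma$ and $\tilde H_{d+1}(\Omega;\mathbb{Z})=\tilde H_d(\Omega;\mathbb{Z})=0$.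 The cocritical group (with respect to $\Omega$) is $K^*(\Sigma)=C_{d+1}(\Omega;\mathbb{Z})/\operatorname{im}(\partial_{d+1}^*\partial_{d+1})$, where $\partial_{d+1}=\partial_{d+1}(\Omega)$. -}

module Defs where

open import Data.Nat as ℕ using (ℕ; zero; suc; _<_)
open import Data.Integer as ℤ using (ℤ)
open import Data.Rational as ℚ using (ℚ)
open import Data.Fin using (Fin)
open import Data.Product using (Σ; ∃; ∃-syntax; _×_; _,_; proj₁; proj₂)
open import Data.Unit using (⊤; tt)
open import Relation.Binary.PropositionalEquality using (_≡_; _≢_)
open import Relation.Nullary using (¬_)

ℤ^ : ℕ → Set
ℤ^ n = Fin n → ℤ

ℚ^ : ℕ → Set
ℚ^ n = Fin n → ℚ

Mat : ℕ → ℕ → Set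
Mat p q = Fin p → Fin q → ℤ

sumℤ : ∀ {n} → (Fin n → ℤ) → ℤ
sumℤ {zero}  f = ℤ.0ℤ
sumℤ {suc n} f = f Fin.zero ℤ.+ sumℤ (λ i → f (Fin.suc i))
  where import Data.Fin as Fin

sumℚ : ∀ {n} → (Fin n → ℚ) → ℚ
sumℚ {zero}  f = ℚ.0ℚ
sumℚ {suc n} f = f Fin.zero ℚ.+ sumℚ (λ i → f (Fin.suc i))
  where import Data.Fin as Fin

infixr 20 _·_
infix 30 _ᵀ
infixl 25 _⊙_

_·_ : ∀ {p q} → Mat p q → ℤ^ q → ℤ^ p
(A · x) i = sumℤ (λ j → A i j ℤ.* x j)

_ᵀ : ∀ {p q} → Mat p q → Mat q p
(A ᵀ) j i = A i j

_⊙_ : ∀ {p q r} → Mat p q → Mat q r → Mat p r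
(A ⊙ B) i k = sumℤ (λ j → A i j ℤ.* B j k)

zeroV : ∀ {n} → ℤ^ n
zeroV _ = ℤ.0ℤ

_+V_ : ∀ {n} → ℤ^ n → ℤ^ n → ℤ^ n
(x +V y) i = x i ℤ.+ y i

_-V_ : ∀ {n} → ℤ^ n → ℤ^ n → ℤ^ n
(x -V y) i = x i ℤ.- y i

_*V_ : ∀ {n} → ℤ → ℤ^ n → ℤ^ n
(a *V x) i = a ℤ.* x i

IsZeroV : ∀ {n} → ℤ^ n → Set
IsZeroV x = ∀ i → x i ≡ ℤ.0ℤ

toℚ : ℤ → ℚ
toℚ z = z ℚ./ 1

_+Q_ : ∀ {n} → ℚ^ n → ℚ^ n → ℚ^ n
(x +Q y) i = x i ℚ.+ y i

_-Q_ : ∀ {n} → ℚ^ n → ℚ^ n → ℚ^ n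
(x -Q y) i = x i ℚ.- y i

zeroQ : ∀ {n} → ℚ^ n
zeroQ _ = ℚ.0ℚ

-- standard inner product on ℚ^n (facets orthonormal)
⟨_,_⟩ : ∀ {n} → ℚ^ n → ℚ^ n → ℚ
⟨ x , y ⟩ = sumℚ (λ i → x i ℚ.* y i)

embed : ∀ {n} → ℤ^ n → ℚ^ n
embed x i = toℚ (x i)

-- Subquotient groups  P / R  of an ambient abelian group of vectors:
-- elements are ambient vectors satisfying the subgroup predicate P, and
-- two are identified when their difference lies in the relation R
-- (R x y  means  x - y ∈ L for the lattice L being divided out).

record SubQuot : Set₁ where
  field
    V    : Set
    _⊕_  : V → V → V
    𝟘    : V
    P    : V → Set
    _≈_  : V → V → Set
  Carrier : Set
  Carrier = Σ V P

record Hom (A B : SubQuot) : Set where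
  module A = SubQuot A
  module B = SubQuot B
  field
    fun  : A.Carrier → B.Carrier
    cong : ∀ a a′ → proj₁ a A.≈ proj₁ a′ → proj₁ (fun a) B.≈ proj₁ (fun a′)
    hom  : ∀ a b c → proj₁ c ≡ proj₁ a A.⊕ proj₁ b →
           proj₁ (fun c) B.≈ (proj₁ (fun a) B.⊕ proj₁ (fun b))
  val : A.Carrier → B.V
  val a = proj₁ (fun a)

Injective : ∀ {A B} → Hom A B → Set
Injective {A} {B} f = ∀ a a′ → val a B.≈ val a′ → proj₁ a A.≈ proj₁ a′
  where open Hom f

Surjective : ∀ {A B} → Hom A B → Set
Surjective {A} {B} f = ∀ (b : B.Carrier) → ∃[ a ] (val a B.≈ proj₁ b)
  where open Hom f

record _≅_ (A B : SubQuot) : Set where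
  field
    iso   : Hom A B
    inj   : Injective iso
    surj  : Surjective iso

record ShortExact (A B C : SubQuot) : Set where
  module B = SubQuot B
  module C = SubQuot C
  field
    f      : Hom A B
    g      : Hom B C
    f-inj  : Injective f
    g-surj : Surjective g
    exact  : ∀ b → (Hom.val g b C.≈ C.𝟘 → ∃[ a ] (Hom.val f a B.≈ proj₁ b))
                 × (∀ a → Hom.val f a B.≈ proj₁ b → Hom.val g b C.≈ C.𝟘)

-- Level k holds the cells of dimension k - 1 (level 0 = the unique
-- (-1)-cell).  ∂ k : C(level k+1) → C(level k), i.e. ∂ k is the paper's
-- ∂_k (mapping k-cells to (k-1)-cells).

record CWChainComplex (d : ℕ) : Set where
  field
    rank     : ℕ → ℕ
    rank-0   : rank 0 ≡ 1                        -- unique (-1)-cell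
    rank-top : ∀ k → suc d < k → rank k ≡ 0
    rank-d   : 0 < rank (suc d)
    ∂        : ∀ k → Mat (rank k) (rank (suc k))
    ∂∂       : ∀ k x → IsZeroV (∂ k · (∂ (suc k) · x))

module _ {d : ℕ} (Σc : CWChainComplex d) where
  open CWChainComplex Σc

  facets : ℕ
  facets = rank (suc d)

  ∂d : Mat (rank d) facets
  ∂d = ∂ d

  InCut : ℤ^ facets → Set
  InCut v = ∃[ y ] (∀ i → v i ≡ (∂d ᵀ · y) i)

  InFlow : ℤ^ facets → Set
  InFlow v = IsZeroV (∂d · v)

  -- (d-1)-cycles: ker ∂_{d-1} at level d (for d = 0 every chain of the
  -- (-1)-cell is a cycle)
  Cycle : ∀ k → ℤ^ (rank k) → Set
  Cycle zero    x = ⊤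
  Cycle (suc k) x = IsZeroV (∂ k · x)

  Boundary : ℤ^ (rank d) → Set
  Boundary x = ∃[ y ] (∀ i → x i ≡ (∂d · y) i)

  TorH : SubQuot
  TorH = record
    { V   = ℤ^ (rank d)
    ; _⊕_ = _+V_
    ; 𝟘   = zeroV
    ; P   = λ x → Cycle d x × ∃[ m ] (m ≢ ℤ.0ℤ × Boundary (m *V x))
    ; _≈_ = λ x y → Boundary (x -V y)
    }

  CutFlowQuot : SubQuot
  CutFlowQuot = record
    { V   = ℤ^ facets
    ; _⊕_ = _+V_
    ; 𝟘   = zeroV
    ; P   = λ _ → ⊤
    ; _≈_ = λ x y → ∃[ c ] ∃[ f ] (InCut c × InFlow f ×
                      (∀ i → (x -V y) i ≡ (c +V f) i))
    }

  -- 𝓕 ⊗ ℝ ∩ ℚ^n : rational linear combinations of flows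
  InFlowSpan : ℚ^ facets → Set
  InFlowSpan v = Σ ℕ λ m → Σ (ℚ^ m) λ a → Σ (Fin m → ℤ^ facets) λ w →
    ((∀ (j : Fin m) → InFlow (w j)) ×
     (∀ i → v i ≡ sumℚ (λ j → a j ℚ.* toℚ (w j i))))

  -- 𝓕^♯ = { v ∈ 𝓕 ⊗ ℝ : ⟨v,w⟩ ∈ ℤ for all w ∈ 𝓕 }   (taken inside ℚ^n)
  InFlowSharp : ℚ^ facets → Set
  InFlowSharp v = InFlowSpan v ×
    (∀ w → InFlow w → ∃[ z ] (⟨ v , embed w ⟩ ≡ toℚ z))

  FlowDiscriminant : SubQuot
  FlowDiscriminant = record
    { V   = ℚ^ facets
    ; _⊕_ = _+Q_
    ; 𝟘   = zeroQ
    ; P   = InFlowSharp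
    ; _≈_ = λ u v → ∃[ f ] (InFlow f × (∀ i → (u -Q v) i ≡ toℚ (f i)))
    }

  -- (Chain-level data of) an acyclization Ω of Σ: m new (d+1)-cells with
  -- boundary map ∂_{d+1} : ℤ^m → ℤ^n, such that ∂_d ∂_{d+1} = 0,
  -- H̃_{d+1}(Ω) = ker ∂_{d+1} = 0 and H̃_d(Ω) = ker ∂_d / im ∂_{d+1} = 0.
  record Acyclization : Set where
    field
      m       : ℕ
      ∂top    : Mat facets m
      ∂∂top   : ∀ x → IsZeroV (∂d · (∂top · x))
      H-top   : ∀ x → IsZeroV (∂top · x) → IsZeroV x
      H-d     : ∀ v → InFlow v → ∃[ x ] (∀ i → v i ≡ (∂top · x) i)

    Cocritical : SubQuot
    Cocritical = record
      { V   = ℤ^ m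
      ; _⊕_ = _+V_
      ; 𝟘   = zeroV
      ; P   = λ _ → ⊤
      ; _≈_ = λ x y → ∃[ z ] (∀ i → (x -V y) i ≡ ((∂top ᵀ ⊙ ∂top) · z) i)
      }

-- Over ℤ, ∂_d has a diagonal form P ∂_d Q = diag(δ₁, …, δ_k) ⊕ 0 (Euclidean elimination; no divisibility
-- among the δ is needed). The last ℓ columns of Q are a basis B of the flow lattice 𝓕, and the cut
-- lattice is Q⁻ᵀ(δ₁ℤ ⊕ ⋯ ⊕ δ_kℤ ⊕ 0).
-- For any basis B of 𝓕 with Gram matrix G = BᵀB, x ↦ B G⁻¹ x induces ℤ^m / Gℤ^m ≅ 𝓕^♯ / 𝓕: its image
-- pairs integrally with 𝓕, and u ∈ 𝓕^♯ is hit by x = (⟨u, Bⱼ⟩)ⱼ since an element of ℚ𝓕 orthogonal to 𝓕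
-- vanishes. With B = ∂_{d+1}(Ω) this is K^*(Σ) ≅ 𝓕^♯ / 𝓕.
-- In the exact sequence, ℤ^n → 𝓕^♯ / 𝓕 is the orthogonal projection b ↦ B G⁻¹ Bᵀ b onto ℚ𝓕, and a
-- torsion class x goes to Q⁻ᵀ(pivot coordinates of P x); in the diagonal coordinates, b projects into 𝓕
-- exactly when b differs by a flow from an element of Q⁻ᵀ(ℤ^k ⊕ 0), which is the image of the torsion.

module Submission where

open import Defs
open import Algebra.Structures using (IsCommutativeRing)
open import Data.Nat as ℕ using (ℕ; zero; suc)
open import Data.Fin using (Fin; zero; suc; _↑ˡ_; _↑ʳ_)
open import Data.Product using (∃; ∃₂; ∃-syntax; _×_; _,_; proj₁; proj₂)
open import Function using (_∘_)
open import Relation.Binary.PropositionalEquality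

module FinSum
  {A : Set} {_+_ _*_ : A → A → A} { -_ : A → A} {0# 1# : A}
  (isCommutativeRing : IsCommutativeRing _≡_ _+_ _*_ -_ 0# 1#)
  (S : ∀ {n} → (Fin n → A) → A)
  (S-[] : (f : Fin 0 → A) → S f ≡ 0#)
  (S-∷ : ∀ {n} (f : Fin (suc n) → A) → S f ≡ f zero + S (f ∘ suc))
  where

  open import Algebra.Bundles using (CommutativeRing)

  private
    commutativeRing : CommutativeRing _ _
    commutativeRing = record { isCommutativeRing = isCommutativeRing }

  open CommutativeRing commutativeRing using (+-identityˡ; +-assoc; *-comm; semiring; ring)
  open import Algebra.Properties.Semiring.Sum semiring
    using (sum; sum-cong-≗; sum-replicate-zero; ∑-distrib-+; ∑-comm; *-distribˡ-sum)
  open import Algebra.Properties.Ring ring using (-1*x≈-x)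
  open ≡-Reasoning

  private
    S≗sum : ∀ {n} (f : Fin n → A) → S f ≡ sum f
    S≗sum {zero}  f = S-[] f
    S≗sum {suc n} f = trans (S-∷ f) (cong (f zero +_) (S≗sum (f ∘ suc)))

  S-cong : ∀ {n} {f g : Fin n → A} → (∀ i → f i ≡ g i) → S f ≡ S g
  S-cong {f = f} {g} f≗g = begin
    S f    ≡⟨ S≗sum f ⟩
    sum f  ≡⟨ sum-cong-≗ f≗g ⟩
    sum g  ≡⟨ S≗sum g ⟨
    S g    ∎

  S-zero : ∀ {n} {f : Fin n → A} → (∀ i → f i ≡ 0#) → S f ≡ 0#
  S-zero {n} {f} f≗0 = trans (S≗sum f) (trans (sum-cong-≗ f≗0) (sum-replicate-zero n))

  S-distrib-+ : ∀ {n} (f g : Fin n → A) → S (λ i → f i + g i) ≡ S f + S g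
  S-distrib-+ f g = begin
    S (λ i → f i + g i)    ≡⟨ S≗sum _ ⟩
    sum (λ i → f i + g i)  ≡⟨ ∑-distrib-+ f g ⟩
    sum f + sum g          ≡⟨ cong₂ _+_ (S≗sum f) (S≗sum g) ⟨
    S f + S g              ∎

  S-scaleˡ : ∀ {n} c (f : Fin n → A) → S (λ i → c * f i) ≡ c * S f
  S-scaleˡ c f = begin
    S (λ i → c * f i)    ≡⟨ S≗sum _ ⟩
    sum (λ i → c * f i)  ≡⟨ *-distribˡ-sum c f ⟨
    c * sum f            ≡⟨ cong (c *_) (S≗sum f) ⟨
    c * S f              ∎

  S-scaleʳ : ∀ {n} c (f : Fin n → A) → S (λ i → f i * c) ≡ S f * c
  S-scaleʳ c f = trans (S-cong (λ i → *-comm (f i) c)) (trans (S-scaleˡ c f) (*-comm c (S f)))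

  S-neg : ∀ {n} (f : Fin n → A) → S (λ i → - f i) ≡ - S f
  S-neg f = trans (S-cong (λ i → sym (-1*x≈-x (f i)))) (trans (S-scaleˡ (- 1#) f) (-1*x≈-x (S f)))

  S-distrib-- : ∀ {n} (f g : Fin n → A) → S (λ i → f i + (- g i)) ≡ S f + (- S g)
  S-distrib-- f g = trans (S-distrib-+ f (λ i → - g i)) (cong (S f +_) (S-neg g))

  S-comm : ∀ {m n} (f : Fin m → Fin n → A) → S (λ i → S (f i)) ≡ S (λ j → S (λ i → f i j))
  S-comm f = begin
    S (λ i → S (f i))              ≡⟨ S-cong (λ i → S≗sum (f i)) ⟩
    S (λ i → sum (f i))            ≡⟨ S≗sum _ ⟩
    sum (λ i → sum (f i))          ≡⟨ ∑-comm f ⟩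
    sum (λ j → sum (λ i → f i j))  ≡⟨ S≗sum _ ⟨
    S (λ j → sum (λ i → f i j))    ≡⟨ S-cong (λ j → S≗sum _) ⟨
    S (λ j → S (λ i → f i j))      ∎

  S-split : ∀ k {m} (f : Fin (k ℕ.+ m) → A) → S f ≡ S (λ a → f (a ↑ˡ m)) + S (λ b → f (k ↑ʳ b))
  S-split zero    f = begin
    S f                         ≡⟨ +-identityˡ (S f) ⟨
    0# + S f                    ≡⟨ cong (_+ S f) (S-[] _) ⟨
    S (λ a → f (a ↑ˡ _)) + S f  ∎
  S-split (suc k) f = begin
    S f                                                                  ≡⟨ S-∷ f ⟩
    f zero + S (f ∘ suc)                                                 ≡⟨ cong (f zero +_) (S-split k (f ∘ suc)) ⟩
    f zero + (S (λ a → f (suc (a ↑ˡ _))) + S (λ b → f (suc (k ↑ʳ b))))   ≡⟨ +-assoc _ _ _ ⟨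
    (f zero + S (λ a → f (suc (a ↑ˡ _)))) + S (λ b → f (suc (k ↑ʳ b)))   ≡⟨ cong (_+ _) (S-∷ _) ⟨
    S (λ a → f (a ↑ˡ _)) + S (λ b → f (suc k ↑ʳ b))                      ∎

module IntegerMatrix where

  open import Data.Integer as ℤ using (ℤ; _+_; _*_)
  import Data.Integer.Properties as ℤP
  open import Data.Integer.Tactic.RingSolver using (solve-∀)
  open import Algebra.Properties.CommutativeSemigroup ℤP.*-commutativeSemigroup using (x∙yz≈y∙xz)
  open import Algebra.Properties.Ring ℤP.+-*-ring using (x[y-z]≈xy-xz)

  open FinSum ℤP.+-*-isCommutativeRing sumℤ (λ _ → refl) (λ _ → refl) public
    renaming ( S-cong to sumℤ-cong; S-zero to sumℤ-zero; S-distrib-+ to sumℤ-distrib-+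
             ; S-distrib-- to sumℤ-distrib--; S-scaleˡ to sumℤ-scaleˡ; S-scaleʳ to sumℤ-scaleʳ
             ; S-comm to sumℤ-comm; S-split to sumℤ-split)
    hiding (S-neg)

  infix 4 _≈V_ _≈M_

  _≈V_ : ∀ {n} → ℤ^ n → ℤ^ n → Set
  x ≈V y = ∀ i → x i ≡ y i

  _≈M_ : ∀ {p q} → Mat p q → Mat p q → Set
  A ≈M B = ∀ i j → A i j ≡ B i j

  ≈V-sym : ∀ {n} {x y : ℤ^ n} → x ≈V y → y ≈V x
  ≈V-sym x≈y i = sym (x≈y i)

  ≈V-trans : ∀ {n} {x y z : ℤ^ n} → x ≈V y → y ≈V z → x ≈V z
  ≈V-trans x≈y y≈z i = trans (x≈y i) (y≈z i)

  ≈M-refl : ∀ {p q} {A : Mat p q} → A ≈M A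
  ≈M-refl i j = refl

  ≈M-sym : ∀ {p q} {A B : Mat p q} → A ≈M B → B ≈M A
  ≈M-sym A≈B i j = sym (A≈B i j)

  ≈M-trans : ∀ {p q} {A B C : Mat p q} → A ≈M B → B ≈M C → A ≈M C
  ≈M-trans A≈B B≈C i j = trans (A≈B i j) (B≈C i j)

  I : ∀ {n} → Mat n n
  I zero    zero    = ℤ.1ℤ
  I zero    (suc j) = ℤ.0ℤ
  I (suc i) zero    = ℤ.0ℤ
  I (suc i) (suc j) = I i j

  I-sym : ∀ {n} (i j : Fin n) → I i j ≡ I j i
  I-sym zero    zero    = refl
  I-sym zero    (suc j) = refl
  I-sym (suc i) zero    = refl
  I-sym (suc i) (suc j) = I-sym i j

  I-diag : ∀ {n} (i : Fin n) → I i i ≡ ℤ.1ℤ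
  I-diag zero    = refl
  I-diag (suc i) = I-diag i

  sum-Iˡ : ∀ {n} (i : Fin n) (f : ℤ^ n) → sumℤ (λ j → I i j * f j) ≡ f i
  sum-Iˡ {suc n} zero f = begin
    ℤ.1ℤ * f zero + sumℤ (λ j → ℤ.0ℤ * f (suc j))  ≡⟨ cong₂ _+_ (ℤP.*-identityˡ (f zero)) (sumℤ-zero (λ j → ℤP.*-zeroˡ (f (suc j)))) ⟩
    f zero + ℤ.0ℤ                                  ≡⟨ ℤP.+-identityʳ (f zero) ⟩
    f zero                                         ∎
    where open ≡-Reasoning
  sum-Iˡ {suc n} (suc i) f = trans (ℤP.+-identityˡ _) (sum-Iˡ i (f ∘ suc))

  sum-Iʳ : ∀ {n} (i : Fin n) (f : ℤ^ n) → sumℤ (λ j → f j * I j i) ≡ f i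
  sum-Iʳ i f = trans (sumℤ-cong (λ j → trans (ℤP.*-comm (f j) (I j i)) (cong (_* f j) (I-sym j i)))) (sum-Iˡ i f)

  dot : ∀ {n} → ℤ^ n → ℤ^ n → ℤ
  dot x y = sumℤ (λ i → x i * y i)

  ·-cong : ∀ {p q} {A B : Mat p q} {x y : ℤ^ q} → A ≈M B → x ≈V y → A · x ≈V B · y
  ·-cong A≈B x≈y i = sumℤ-cong (λ j → cong₂ _*_ (A≈B i j) (x≈y j))

  ·-congʳ : ∀ {p q} (A : Mat p q) {x y : ℤ^ q} → x ≈V y → A · x ≈V A · y
  ·-congʳ A = ·-cong {A = A} ≈M-refl

  ·-distrib-+ : ∀ {p q} (A : Mat p q) (x y : ℤ^ q) → A · (x +V y) ≈V (A · x) +V (A · y)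
  ·-distrib-+ {q = q} A x y i = trans (sumℤ-cong (λ j → ℤP.*-distribˡ-+ (A i j) (x j) (y j))) (sumℤ-distrib-+ {q} _ _)

  ·-distrib-- : ∀ {p q} (A : Mat p q) (x y : ℤ^ q) → A · (x -V y) ≈V (A · x) -V (A · y)
  ·-distrib-- {q = q} A x y i = trans (sumℤ-cong (λ j → x[y-z]≈xy-xz (A i j) (x j) (y j))) (sumℤ-distrib-- {q} _ _)

  ·-scale : ∀ {p q} (A : Mat p q) (c : ℤ) (x : ℤ^ q) → A · (c *V x) ≈V c *V (A · x)
  ·-scale A c x i = trans (sumℤ-cong (λ j → x∙yz≈y∙xz (A i j) c (x j))) (sumℤ-scaleˡ c (λ j → A i j * x j))

  ·-zero : ∀ {p q} (A : Mat p q) {x : ℤ^ q} → IsZeroV x → IsZeroV (A · x)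
  ·-zero A x≈0 i = sumℤ-zero (λ j → trans (cong (A i j *_) (x≈0 j)) (ℤP.*-zeroʳ (A i j)))

  ·-zeroV : ∀ {p q} (A : Mat p q) → IsZeroV (A · zeroV)
  ·-zeroV A = ·-zero A (λ _ → refl)

  basis : ∀ {n} → Fin n → ℤ^ n
  basis l j = I l j

  ·-basis : ∀ {p q} (A : Mat p q) (j : Fin q) → A · basis j ≈V (λ i → A i j)
  ·-basis A j i = trans (sumℤ-cong (λ l → cong (A i l *_) (I-sym j l))) (sum-Iʳ j (A i))

  I-· : ∀ {n} (x : ℤ^ n) → I · x ≈V x
  I-· x i = sum-Iˡ i x

  ⊙-· : ∀ {p q r} (A : Mat p q) (B : Mat q r) (x : ℤ^ r) → (A ⊙ B) · x ≈V A · (B · x)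
  ⊙-· {r = r} A B x i = begin
    sumℤ (λ k → sumℤ (λ j → A i j * B j k) * x k)  ≡⟨ sumℤ-cong (λ k → sym (sumℤ-scaleʳ (x k) (λ j → A i j * B j k))) ⟩
    sumℤ (λ k → sumℤ (λ j → A i j * B j k * x k))  ≡⟨ sumℤ-comm (λ k j → A i j * B j k * x k) ⟩
    sumℤ (λ j → sumℤ (λ k → A i j * B j k * x k))  ≡⟨ sumℤ-cong (λ j → trans (sumℤ-cong {r} (λ k → ℤP.*-assoc (A i j) _ _)) (sumℤ-scaleˡ (A i j) (λ k → B j k * x k))) ⟩
    sumℤ (λ j → A i j * sumℤ (λ k → B j k * x k))  ∎
    where open ≡-Reasoning

  ⊙-cong : ∀ {p q r} {A A′ : Mat p q} {B B′ : Mat q r} → A ≈M A′ → B ≈M B′ → A ⊙ B ≈M A′ ⊙ B′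
  ⊙-cong A≈A′ B≈B′ i k = sumℤ-cong (λ j → cong₂ _*_ (A≈A′ i j) (B≈B′ j k))

  ⊙-congˡ : ∀ {p q r} (A : Mat p q) {B B′ : Mat q r} → B ≈M B′ → A ⊙ B ≈M A ⊙ B′
  ⊙-congˡ A = ⊙-cong {A = A} ≈M-refl

  ⊙-congʳ : ∀ {p q r} {A A′ : Mat p q} (B : Mat q r) → A ≈M A′ → A ⊙ B ≈M A′ ⊙ B
  ⊙-congʳ B A≈A′ = ⊙-cong A≈A′ (≈M-refl {A = B})

  ⊙-assoc : ∀ {p q r s} (A : Mat p q) (B : Mat q r) (C : Mat r s) → (A ⊙ B) ⊙ C ≈M A ⊙ (B ⊙ C)
  ⊙-assoc A B C i l = ⊙-· A B (λ j → C j l) i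

  I-⊙ : ∀ {p q} (A : Mat p q) → I ⊙ A ≈M A
  I-⊙ A i j = sum-Iˡ i (λ k → A k j)

  ⊙-I : ∀ {p q} (A : Mat p q) → A ⊙ I ≈M A
  ⊙-I A i j = sum-Iʳ j (A i)

  ᵀ-⊙ : ∀ {p q r} (A : Mat p q) (B : Mat q r) → (A ⊙ B) ᵀ ≈M B ᵀ ⊙ A ᵀ
  ᵀ-⊙ A B k i = sumℤ-cong (λ j → ℤP.*-comm (A i j) (B j k))

  dot-comm : ∀ {n} (x y : ℤ^ n) → dot x y ≡ dot y x
  dot-comm x y = sumℤ-cong (λ i → ℤP.*-comm (x i) (y i))

  dot-congˡ : ∀ {n} {x y : ℤ^ n} (z : ℤ^ n) → x ≈V y → dot x z ≡ dot y z
  dot-congˡ z x≈y = sumℤ-cong (λ i → cong (_* z i) (x≈y i))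

  dot-congʳ : ∀ {n} (x : ℤ^ n) {y z} → y ≈V z → dot x y ≡ dot x z
  dot-congʳ x y≈z = sumℤ-cong (λ i → cong (x i *_) (y≈z i))

  dot-scaleʳ : ∀ {n} (x : ℤ^ n) c y → dot x (c *V y) ≡ c * dot x y
  dot-scaleʳ x c y = trans (sumℤ-cong (λ i → x∙yz≈y∙xz (x i) c (y i))) (sumℤ-scaleˡ c (λ i → x i * y i))

  dot-zeroʳ : ∀ {n} (x : ℤ^ n) {y : ℤ^ n} → IsZeroV y → dot x y ≡ ℤ.0ℤ
  dot-zeroʳ x y≈0 = sumℤ-zero (λ i → trans (cong (x i *_) (y≈0 i)) (ℤP.*-zeroʳ (x i)))

  dot-adjoint : ∀ {p q} (A : Mat p q) (y : ℤ^ p) (x : ℤ^ q) → dot (A ᵀ · y) x ≡ dot y (A · x)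
  dot-adjoint A y x = begin
    sumℤ (λ j → sumℤ (λ i → A i j * y i) * x j)  ≡⟨ sumℤ-cong (λ j → sym (sumℤ-scaleʳ (x j) (λ i → A i j * y i))) ⟩
    sumℤ (λ j → sumℤ (λ i → A i j * y i * x j))  ≡⟨ sumℤ-comm (λ j i → A i j * y i * x j) ⟩
    sumℤ (λ i → sumℤ (λ j → A i j * y i * x j))  ≡⟨ sumℤ-cong (λ i → trans (sumℤ-cong (λ j → reorder (A i j) (y i) (x j))) (sumℤ-scaleˡ (y i) (λ j → A i j * x j))) ⟩
    sumℤ (λ i → y i * sumℤ (λ j → A i j * x j))  ∎
    where
    open ≡-Reasoning
    reorder : ∀ a y x → a * y * x ≡ y * (a * x)
    reorder = solve-∀

module Blocks where

  open import Data.Integer as ℤ using (ℤ; _+_; _-_; _*_)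
  open IntegerMatrix

  data Split (k m : ℕ) : Fin (k ℕ.+ m) → Set where
    upper : (a : Fin k) → Split k m (a ↑ˡ m)
    lower : (l : Fin m) → Split k m (k ↑ʳ l)

  split : ∀ k m (i : Fin (k ℕ.+ m)) → Split k m i
  split zero    m i       = lower i
  split (suc k) m zero    = upper zero
  split (suc k) m (suc i) with split k m i
  ... | upper a = upper (suc a)
  ... | lower l = lower l

  ≈V-by-blocks : ∀ {k m} {u v : ℤ^ (k ℕ.+ m)} → (∀ a → u (a ↑ˡ m) ≡ v (a ↑ˡ m)) → (∀ l → u (k ↑ʳ l) ≡ v (k ↑ʳ l)) → u ≈V v
  ≈V-by-blocks {k} {m} upper≡ lower≡ i with split k m i
  ... | upper a = upper≡ a
  ... | lower l = lower≡ l

  keepUpper : ∀ {k p q} → ℤ^ (k ℕ.+ p) → ℤ^ (k ℕ.+ q)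
  keepUpper {zero}  z i       = ℤ.0ℤ
  keepUpper {suc k} z zero    = z zero
  keepUpper {suc k} z (suc i) = keepUpper {k} (z ∘ suc) i

  keepUpper-upper : ∀ {k p q} (z : ℤ^ (k ℕ.+ p)) (a : Fin k) → keepUpper {k} {p} {q} z (a ↑ˡ q) ≡ z (a ↑ˡ p)
  keepUpper-upper z zero    = refl
  keepUpper-upper z (suc a) = keepUpper-upper (z ∘ suc) a

  keepUpper-lower : ∀ {k p q} (z : ℤ^ (k ℕ.+ p)) (l : Fin q) → keepUpper {k} {p} {q} z (k ↑ʳ l) ≡ ℤ.0ℤ
  keepUpper-lower {zero}  z l = refl
  keepUpper-lower {suc k} z l = keepUpper-lower {k} (z ∘ suc) l

  module KeepUpper (k p q : ℕ) where

    T : ℤ^ (k ℕ.+ p) → ℤ^ (k ℕ.+ q)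
    T = keepUpper {k} {p} {q}

    T-upper : ∀ z (a : Fin k) → T z (a ↑ˡ q) ≡ z (a ↑ˡ p)
    T-upper = keepUpper-upper {k} {p} {q}

    T-lower : ∀ z (l : Fin q) → T z (k ↑ʳ l) ≡ ℤ.0ℤ
    T-lower = keepUpper-lower {k} {p} {q}

    T-cong : ∀ {u v} → u ≈V v → T u ≈V T v
    T-cong {u} {v} u≈v = ≈V-by-blocks
      (λ a → trans (T-upper u a) (trans (u≈v (a ↑ˡ p)) (sym (T-upper v a))))
      (λ l → trans (T-lower u l) (sym (T-lower v l)))

    T-+ : ∀ u v → T (u +V v) ≈V T u +V T v
    T-+ u v = ≈V-by-blocks
      (λ a → trans (T-upper (u +V v) a) (sym (cong₂ _+_ (T-upper u a) (T-upper v a))))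
      (λ l → trans (T-lower (u +V v) l) (sym (cong₂ _+_ (T-lower u l) (T-lower v l))))

    T-- : ∀ u v → T (u -V v) ≈V T u -V T v
    T-- u v = ≈V-by-blocks
      (λ a → trans (T-upper (u -V v) a) (sym (cong₂ _-_ (T-upper u a) (T-upper v a))))
      (λ l → trans (T-lower (u -V v) l) (sym (cong₂ _-_ (T-lower u l) (T-lower v l))))

  embedLower : ∀ {k m} → ℤ^ m → ℤ^ (k ℕ.+ m)
  embedLower {zero}  x i       = x i
  embedLower {suc k} x zero    = ℤ.0ℤ
  embedLower {suc k} x (suc i) = embedLower {k} x i

  embedLower-upper : ∀ {k m} (x : ℤ^ m) (a : Fin k) → embedLower {k} x (a ↑ˡ m) ≡ ℤ.0ℤ
  embedLower-upper x zero    = refl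
  embedLower-upper x (suc a) = embedLower-upper x a

  embedLower-lower : ∀ {k m} (x : ℤ^ m) (l : Fin m) → embedLower {k} x (k ↑ʳ l) ≡ x l
  embedLower-lower {zero}  x l = refl
  embedLower-lower {suc k} x l = embedLower-lower {k} x l

  dot-split : ∀ k {m} (u v : ℤ^ (k ℕ.+ m)) →
              dot u v ≡ sumℤ (λ a → u (a ↑ˡ m) * v (a ↑ˡ m)) + sumℤ (λ l → u (k ↑ʳ l) * v (k ↑ʳ l))
  dot-split k u v = sumℤ-split k (λ i → u i * v i)

module InvertibleMatrix where

  open import Data.Fin.Properties using (_≟_)
  open import Data.Integer as ℤ using (ℤ; -_; _+_; _*_)
  import Data.Integer.Properties as ℤP
  open import Data.Integer.Tactic.RingSolver using (solve-∀)
  open import Data.Empty using (⊥-elim)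
  open import Relation.Nullary using (yes; no)
  open IntegerMatrix

  record Invertible (a b : ℕ) : Set where
    field
      M      : Mat a b
      M⁻¹    : Mat b a
      M⊙M⁻¹  : M ⊙ M⁻¹ ≈M I
      M⁻¹⊙M  : M⁻¹ ⊙ M ≈M I

  Invertible-id : ∀ {n} → Invertible n n
  Invertible-id = record { M = I ; M⁻¹ = I ; M⊙M⁻¹ = I-⊙ I ; M⁻¹⊙M = I-⊙ I }

  ⊙-inverse : ∀ {a b c} (X : Mat a b) (X′ : Mat b a) (Y : Mat b c) (Y′ : Mat c b) →
              X ⊙ X′ ≈M I → Y ⊙ Y′ ≈M I → (X ⊙ Y) ⊙ (Y′ ⊙ X′) ≈M I
  ⊙-inverse X X′ Y Y′ XX′≈I YY′≈I =
    ≈M-trans (⊙-assoc X Y (Y′ ⊙ X′))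
    (≈M-trans (⊙-congˡ X (≈M-sym (⊙-assoc Y Y′ X′)))
    (≈M-trans (⊙-congˡ X (⊙-congʳ X′ YY′≈I))
    (≈M-trans (⊙-congˡ X (I-⊙ X′)) XX′≈I)))

  infixr 9 _∘ᴵ_

  _∘ᴵ_ : ∀ {a b c} → Invertible a b → Invertible b c → Invertible a c
  X ∘ᴵ Y = record
    { M = X.M ⊙ Y.M ; M⁻¹ = Y.M⁻¹ ⊙ X.M⁻¹
    ; M⊙M⁻¹ = ⊙-inverse X.M X.M⁻¹ Y.M Y.M⁻¹ X.M⊙M⁻¹ Y.M⊙M⁻¹
    ; M⁻¹⊙M = ⊙-inverse Y.M⁻¹ Y.M X.M⁻¹ X.M Y.M⁻¹⊙M X.M⁻¹⊙M }
    where module X = Invertible X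
          module Y = Invertible Y

  Invertible-ᵀ : ∀ {a b} → Invertible a b → Invertible b a
  Invertible-ᵀ X = record
    { M = X.M ᵀ ; M⁻¹ = X.M⁻¹ ᵀ
    ; M⊙M⁻¹ = ≈M-trans (≈M-sym (ᵀ-⊙ X.M⁻¹ X.M)) (λ i j → trans (X.M⁻¹⊙M j i) (I-sym j i))
    ; M⁻¹⊙M = ≈M-trans (≈M-sym (ᵀ-⊙ X.M X.M⁻¹)) (λ i j → trans (X.M⊙M⁻¹ j i) (I-sym j i)) }
    where module X = Invertible X

  ⊙-reassoc : ∀ {a b c d e f} (X : Mat a b) (Y : Mat b c) (A : Mat c d) (Z : Mat d e) (W : Mat e f) →
              ((X ⊙ Y) ⊙ A) ⊙ (Z ⊙ W) ≈M (X ⊙ ((Y ⊙ A) ⊙ Z)) ⊙ W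
  ⊙-reassoc X Y A Z W =
    ≈M-trans (⊙-congʳ (Z ⊙ W) (⊙-assoc X Y A))
    (≈M-trans (≈M-sym (⊙-assoc (X ⊙ (Y ⊙ A)) Z W))
    (⊙-congʳ W (⊙-assoc X (Y ⊙ A) Z)))

  permMatrix : ∀ {n} → (Fin n → Fin n) → Mat n n
  permMatrix σ x y = I (σ x) y

  permMatrix-⊙ : ∀ {n q} (σ : Fin n → Fin n) (X : Mat n q) → permMatrix σ ⊙ X ≈M (λ x y → X (σ x) y)
  permMatrix-⊙ σ X x y = sum-Iˡ (σ x) (λ j → X j y)

  ⊙-permMatrixᵀ : ∀ {n p} (σ : Fin n → Fin n) (X : Mat p n) → X ⊙ permMatrix σ ᵀ ≈M (λ x y → X x (σ y))
  ⊙-permMatrixᵀ σ X x y = trans (sumℤ-cong (λ j → cong (X x j *_) (I-sym (σ y) j))) (sum-Iʳ (σ y) (X x))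

  involution-invertible : ∀ {n} (σ : Fin n → Fin n) → (∀ x → σ (σ x) ≡ x) → Invertible n n
  involution-invertible σ σσ≗id = record { M = permMatrix σ ; M⁻¹ = permMatrix σ ; M⊙M⁻¹ = σ⊙σ ; M⁻¹⊙M = σ⊙σ }
    where σ⊙σ : permMatrix σ ⊙ permMatrix σ ≈M I
          σ⊙σ x y = trans (permMatrix-⊙ σ (permMatrix σ) x y) (cong (λ z → I z y) (σσ≗id x))

  swapWithZero : ∀ {n} → Fin (suc n) → Fin (suc n) → Fin (suc n)
  swapWithZero a zero = a
  swapWithZero a (suc x) with suc x ≟ a
  ... | yes _ = zero
  ... | no  _ = suc x

  swapWithZero-self : ∀ {n} (a : Fin (suc n)) → swapWithZero a a ≡ zero
  swapWithZero-self zero = refl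
  swapWithZero-self (suc a) with suc a ≟ suc a
  ... | yes _   = refl
  ... | no  a≢a = ⊥-elim (a≢a refl)

  swapWithZero-involutive : ∀ {n} (a : Fin (suc n)) x → swapWithZero a (swapWithZero a x) ≡ x
  swapWithZero-involutive a zero = swapWithZero-self a
  swapWithZero-involutive a (suc x) with suc x ≟ a
  ... | yes x≡a = sym x≡a
  ... | no  x≢a with suc x ≟ a
  ...   | yes x≡a = ⊥-elim (x≢a x≡a)
  ...   | no  _   = refl

  swapMatrix : ∀ {n} → Fin (suc n) → Invertible (suc n) (suc n)
  swapMatrix a = involution-invertible (swapWithZero a) (swapWithZero-involutive a)

  shearMatrix : ∀ {r} → (Fin r → ℤ) → Mat (suc r) (suc r)
  shearMatrix q zero    y       = I zero y
  shearMatrix q (suc i) zero    = - q i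
  shearMatrix q (suc i) (suc j) = I i j

  shear-⊙-zero : ∀ {r p} (q : Fin r → ℤ) (X : Mat (suc r) p) y → (shearMatrix q ⊙ X) zero y ≡ X zero y
  shear-⊙-zero q X y = sum-Iˡ zero (λ j → X j y)

  shear-⊙-suc : ∀ {r p} (q : Fin r → ℤ) (X : Mat (suc r) p) i y →
                (shearMatrix q ⊙ X) (suc i) y ≡ - q i * X zero y + X (suc i) y
  shear-⊙-suc q X i y = cong ((- q i * X zero y) +_) (sum-Iˡ i (λ j → X (suc j) y))

  ⊙-shearᵀ-zero : ∀ {r p} (q : Fin r → ℤ) (X : Mat p (suc r)) x → (X ⊙ shearMatrix q ᵀ) x zero ≡ X x zero
  ⊙-shearᵀ-zero q X x = trans (sumℤ-cong (λ j → cong (X x j *_) (I-sym zero j))) (sum-Iʳ zero (X x))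

  ⊙-shearᵀ-suc : ∀ {r p} (q : Fin r → ℤ) (X : Mat p (suc r)) x j →
                 (X ⊙ shearMatrix q ᵀ) x (suc j) ≡ X x zero * - q j + X x (suc j)
  ⊙-shearᵀ-suc q X x j =
    cong ((X x zero * - q j) +_) (trans (sumℤ-cong (λ l → cong (X x (suc l) *_) (I-sym j l))) (sum-Iʳ j (X x ∘ suc)))

  shear-inverse : ∀ {r} (q q′ : Fin r → ℤ) → (∀ i → q i + q′ i ≡ ℤ.0ℤ) → shearMatrix q ⊙ shearMatrix q′ ≈M I
  shear-inverse q q′ q+q′≡0 zero    y       = shear-⊙-zero q (shearMatrix q′) y
  shear-inverse q q′ q+q′≡0 (suc i) zero    =
    trans (shear-⊙-suc q (shearMatrix q′) i zero) (trans (negate-sum (q i) (q′ i)) (cong -_ (q+q′≡0 i)))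
    where negate-sum : ∀ a b → - a * ℤ.1ℤ + - b ≡ - (a + b)
          negate-sum = solve-∀
  shear-inverse q q′ q+q′≡0 (suc i) (suc j) =
    trans (shear-⊙-suc q (shearMatrix q′) i (suc j)) (trans (cong (_+ I i j) (ℤP.*-zeroʳ (- q i))) (ℤP.+-identityˡ _))

  shear-invertible : ∀ {r} (q : Fin r → ℤ) → Invertible (suc r) (suc r)
  shear-invertible q = record
    { M = shearMatrix q ; M⁻¹ = shearMatrix (-_ ∘ q)
    ; M⊙M⁻¹ = shear-inverse q _ (λ i → ℤP.+-inverseʳ (q i))
    ; M⁻¹⊙M = shear-inverse _ q (λ i → ℤP.+-inverseˡ (q i)) }

  module _ {a b} (X : Invertible a b) where
    open Invertible X

    M⁻¹·M·x≈x : ∀ x → M⁻¹ · (M · x) ≈V x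
    M⁻¹·M·x≈x x i = trans (sym (⊙-· M⁻¹ M x i)) (trans (·-cong M⁻¹⊙M (λ _ → refl) i) (I-· x i))

    M·M⁻¹·x≈x : ∀ x → M · (M⁻¹ · x) ≈V x
    M·M⁻¹·x≈x x i = trans (sym (⊙-· M M⁻¹ x i)) (trans (·-cong M⊙M⁻¹ (λ _ → refl) i) (I-· x i))

module DiagonalForm where

  open import Data.Nat using () renaming (_<_ to _<ℕ_)
  import Data.Nat.Properties as ℕP
  open import Data.Integer as ℤ using (ℤ; -_; _+_; _*_; ∣_∣)
  import Data.Integer.Properties as ℤP
  open import Data.Integer.DivMod using (_/_; _%_; a≡a%n+[a/n]*n; n%d<d)
  open import Data.Integer.Tactic.RingSolver using (solve-∀)
  open import Data.Sum using (_⊎_; inj₁; inj₂)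
  open import Relation.Nullary using (yes; no)
  open IntegerMatrix
  open Blocks
  open InvertibleMatrix

  nonzero? : ∀ {n} (f : ℤ^ n) → (∃ λ i → f i ≢ ℤ.0ℤ) ⊎ IsZeroV f
  nonzero? {zero}  f = inj₂ (λ ())
  nonzero? {suc n} f with f zero ℤP.≟ ℤ.0ℤ
  ... | no  f₀≢0 = inj₁ (zero , f₀≢0)
  ... | yes f₀≡0 with nonzero? (f ∘ suc)
  ...   | inj₁ (i , fᵢ≢0) = inj₁ (suc i , fᵢ≢0)
  ...   | inj₂ f≗0        = inj₂ λ { zero → f₀≡0 ; (suc i) → f≗0 i }

  nonzeroEntry? : ∀ {r n} (A : Mat r n) → (∃₂ λ i j → A i j ≢ ℤ.0ℤ) ⊎ (∀ i j → A i j ≡ ℤ.0ℤ)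
  nonzeroEntry? {zero}  A = inj₂ (λ ())
  nonzeroEntry? {suc r} A with nonzero? (A zero)
  ... | inj₁ (j , A₀ⱼ≢0) = inj₁ (zero , j , A₀ⱼ≢0)
  ... | inj₂ A₀≗0 with nonzeroEntry? (A ∘ suc)
  ...   | inj₁ (i , j , Aᵢⱼ≢0) = inj₁ (suc i , j , Aᵢⱼ≢0)
  ...   | inj₂ A≗0             = inj₂ λ { zero j → A₀≗0 j ; (suc i) j → A≗0 i j }

  record PivotForm {r n} (A : Mat (suc r) (suc n)) : Set where
    field
      U          : Invertible (suc r) (suc r)
      V          : Invertible (suc n) (suc n)
      B          : Mat (suc r) (suc n)
      UAV≈B      : (Invertible.M U ⊙ A) ⊙ Invertible.M V ≈M B
      pivot≢0    : B zero zero ≢ ℤ.0ℤ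
      column≗0   : ∀ i → B (suc i) zero ≡ ℤ.0ℤ
      row≗0      : ∀ j → B zero (suc j) ≡ ℤ.0ℤ

  pivotForm-resp-≈ : ∀ {r n} {A A′ : Mat (suc r) (suc n)} → A ≈M A′ → PivotForm A′ → PivotForm A
  pivotForm-resp-≈ A≈A′ pf = record
    { U = U ; V = V ; B = B ; pivot≢0 = pivot≢0 ; column≗0 = column≗0 ; row≗0 = row≗0
    ; UAV≈B = ≈M-trans (⊙-congʳ (Invertible.M V) (⊙-congˡ (Invertible.M U) A≈A′)) UAV≈B }
    where open PivotForm pf

  pivotForm-transport : ∀ {r n} {A : Mat (suc r) (suc n)} (U₁ : Invertible (suc r) (suc r)) (V₁ : Invertible (suc n) (suc n)) →
                        PivotForm ((Invertible.M U₁ ⊙ A) ⊙ Invertible.M V₁) → PivotForm A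
  pivotForm-transport {A = A} U₁ V₁ pf = record
    { U = U ∘ᴵ U₁ ; V = V₁ ∘ᴵ V ; B = B ; pivot≢0 = pivot≢0 ; column≗0 = column≗0 ; row≗0 = row≗0
    ; UAV≈B = ≈M-trans (⊙-reassoc (Invertible.M U) (Invertible.M U₁) A (Invertible.M V₁) (Invertible.M V)) UAV≈B }
    where open PivotForm pf

  -- Euclidean descent on ∣pivot∣: a shear reduces the rest of the first column (row) modulo the
  -- pivot, and a nonzero remainder is swapped in as a strictly smaller pivot.
  Descent : ∀ {r n} → ℕ → Set
  Descent {r} {n} bound = (A : Mat (suc r) (suc n)) → A zero zero ≢ ℤ.0ℤ → ∣ A zero zero ∣ <ℕ bound → PivotForm A

  remainder-by-shear : ∀ a p .{{_ : ℤ.NonZero p}} → - (a / p) * p + a ≡ ℤ.+ (a % p)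
  remainder-by-shear a p = trans (cong ((- (a / p) * p) +_) (a≡a%n+[a/n]*n a p)) (cancel (a / p) p (ℤ.+ (a % p)))
    where cancel : ∀ x p r → - x * p + (r + x * p) ≡ r
          cancel = solve-∀

  remainder-smaller : ∀ {bound} a p .{{_ : ℤ.NonZero p}} → ∣ p ∣ <ℕ suc bound → ∣ ℤ.+ (a % p) ∣ <ℕ bound
  remainder-smaller a p ∣p∣<1+b = ℕP.<-≤-trans (n%d<d a p) (ℕP.≤-pred ∣p∣<1+b)

  clearRow : ∀ {r n} {bound} (A : Mat (suc r) (suc n)) → A zero zero ≢ ℤ.0ℤ → ∣ A zero zero ∣ <ℕ suc bound →
             (∀ i → A (suc i) zero ≡ ℤ.0ℤ) → Descent bound → PivotForm A
  clearRow {r} {n} A p≢0 ∣p∣<b column≗0 descend = byCases (nonzero? (λ j → A′ zero (suc j)))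
    where
    p = A zero zero
    instance _ = ℤ.≢-nonZero p≢0
    q : Fin n → ℤ
    q j = A zero (suc j) / p
    A′ = A ⊙ shearMatrix q ᵀ
    swapᵀ : Fin n → Mat (suc n) (suc n)
    swapᵀ j = permMatrix (swapWithZero (suc j)) ᵀ
    A′₀ⱼ≡rem : ∀ j → A′ zero (suc j) ≡ ℤ.+ (A zero (suc j) % p)
    A′₀ⱼ≡rem j = trans (⊙-shearᵀ-suc q A zero j)
                   (trans (cong (_+ A zero (suc j)) (ℤP.*-comm p (- q j))) (remainder-by-shear (A zero (suc j)) p))
    byCases : (∃ λ j → A′ zero (suc j) ≢ ℤ.0ℤ) ⊎ IsZeroV (λ j → A′ zero (suc j)) → PivotForm A
    byCases (inj₂ row≗0) = record
      { U = Invertible-id ; V = Invertible-ᵀ (shear-invertible q) ; B = A′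
      ; UAV≈B = ⊙-congʳ (shearMatrix q ᵀ) (I-⊙ A)
      ; pivot≢0 = λ A′₀₀≡0 → p≢0 (trans (sym (⊙-shearᵀ-zero q A zero)) A′₀₀≡0)
      ; column≗0 = λ i → trans (⊙-shearᵀ-zero q A (suc i)) (column≗0 i) ; row≗0 = row≗0 }
    byCases (inj₁ (j , A′₀ⱼ≢0)) =
      pivotForm-transport Invertible-id (Invertible-ᵀ (shear-invertible q) ∘ᴵ Invertible-ᵀ (swapMatrix (suc j)))
        (pivotForm-resp-≈ (≈M-trans (⊙-congʳ (shearMatrix q ᵀ ⊙ swapᵀ j) (I-⊙ A)) (≈M-sym (⊙-assoc A (shearMatrix q ᵀ) (swapᵀ j))))
          (pivotForm-resp-≈ (⊙-permMatrixᵀ (swapWithZero (suc j)) A′)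
            (descend _ A′₀ⱼ≢0 (subst (λ z → ∣ z ∣ <ℕ _) (sym (A′₀ⱼ≡rem j)) (remainder-smaller (A zero (suc j)) p ∣p∣<b)))))

  clearColumn : ∀ {r n} {bound} (A : Mat (suc r) (suc n)) → A zero zero ≢ ℤ.0ℤ → ∣ A zero zero ∣ <ℕ suc bound →
                Descent bound → PivotForm A
  clearColumn {r} {n} A p≢0 ∣p∣<b descend = byCases (nonzero? (λ i → A′ (suc i) zero))
    where
    p = A zero zero
    instance _ = ℤ.≢-nonZero p≢0
    q : Fin r → ℤ
    q i = A (suc i) zero / p
    A′ = shearMatrix q ⊙ A
    A′ᵢ₀≡rem : ∀ i → A′ (suc i) zero ≡ ℤ.+ (A (suc i) zero % p)
    A′ᵢ₀≡rem i = trans (shear-⊙-suc q A i zero) (remainder-by-shear (A (suc i) zero) p)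
    swap : Fin r → Mat (suc r) (suc r)
    swap i = permMatrix (swapWithZero (suc i))
    byCases : (∃ λ i → A′ (suc i) zero ≢ ℤ.0ℤ) ⊎ IsZeroV (λ i → A′ (suc i) zero) → PivotForm A
    byCases (inj₂ column≗0) =
      pivotForm-transport (shear-invertible q) Invertible-id
        (pivotForm-resp-≈ (⊙-I A′)
          (clearRow A′ (λ A′₀₀≡0 → p≢0 (trans (sym (shear-⊙-zero q A zero)) A′₀₀≡0))
                       (subst (λ z → ∣ z ∣ <ℕ _) (sym (shear-⊙-zero q A zero)) ∣p∣<b) column≗0 descend))
    byCases (inj₁ (i , A′ᵢ₀≢0)) =
      pivotForm-transport (swapMatrix (suc i) ∘ᴵ shear-invertible q) Invertible-id
        (pivotForm-resp-≈ (≈M-trans (⊙-I _) (⊙-assoc (swap i) (shearMatrix q) A))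
          (pivotForm-resp-≈ (permMatrix-⊙ (swapWithZero (suc i)) A′)
            (descend _ A′ᵢ₀≢0 (subst (λ z → ∣ z ∣ <ℕ _) (sym (A′ᵢ₀≡rem i)) (remainder-smaller (A (suc i) zero) p ∣p∣<b)))))

  pivotForm-descent : ∀ {r n} bound → Descent {r} {n} bound
  pivotForm-descent zero        A p≢0 ()
  pivotForm-descent (suc bound) A p≢0 ∣p∣<b = clearColumn A p≢0 ∣p∣<b (pivotForm-descent bound)

  infixr 6 [_]⊕_

  [_]⊕_ : ∀ {a b} → ℤ → Mat a b → Mat (suc a) (suc b)
  ([ c ]⊕ X) zero    zero    = c
  ([ c ]⊕ X) zero    (suc j) = ℤ.0ℤ
  ([ c ]⊕ X) (suc i) zero    = ℤ.0ℤ
  ([ c ]⊕ X) (suc i) (suc j) = X i j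

  ⊕-⊙ : ∀ {a b e} (c c′ : ℤ) (X : Mat a b) (Y : Mat b e) → ([ c ]⊕ X) ⊙ ([ c′ ]⊕ Y) ≈M [ c * c′ ]⊕ (X ⊙ Y)
  ⊕-⊙ {b = b} c c′ X Y zero    zero    = trans (cong ((c * c′) +_) (sumℤ-zero {b} (λ j → ℤP.*-zeroˡ ℤ.0ℤ))) (ℤP.+-identityʳ _)
  ⊕-⊙         c c′ X Y zero    (suc k) = cong₂ _+_ (ℤP.*-zeroʳ c) (sumℤ-zero (λ j → ℤP.*-zeroˡ (Y j k)))
  ⊕-⊙         c c′ X Y (suc i) zero    = cong₂ _+_ (ℤP.*-zeroˡ c′) (sumℤ-zero (λ j → ℤP.*-zeroʳ (X i j)))
  ⊕-⊙         c c′ X Y (suc i) (suc k) = ℤP.+-identityˡ _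

  ⊕-cong : ∀ {a b} c {X Y : Mat a b} → X ≈M Y → [ c ]⊕ X ≈M [ c ]⊕ Y
  ⊕-cong c X≈Y zero    zero    = refl
  ⊕-cong c X≈Y zero    (suc j) = refl
  ⊕-cong c X≈Y (suc i) zero    = refl
  ⊕-cong c X≈Y (suc i) (suc j) = X≈Y i j

  ⊕-I : ∀ {n} → [ ℤ.1ℤ ]⊕ I {n} ≈M I
  ⊕-I zero    zero    = refl
  ⊕-I zero    (suc j) = refl
  ⊕-I (suc i) zero    = refl
  ⊕-I (suc i) (suc j) = refl

  ⊕-invertible : ∀ {a b} → Invertible a b → Invertible (suc a) (suc b)
  ⊕-invertible X = record
    { M = [ ℤ.1ℤ ]⊕ X.M ; M⁻¹ = [ ℤ.1ℤ ]⊕ X.M⁻¹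
    ; M⊙M⁻¹ = ≈M-trans (⊕-⊙ ℤ.1ℤ ℤ.1ℤ X.M X.M⁻¹) (≈M-trans (⊕-cong ℤ.1ℤ X.M⊙M⁻¹) ⊕-I)
    ; M⁻¹⊙M = ≈M-trans (⊕-⊙ ℤ.1ℤ ℤ.1ℤ X.M⁻¹ X.M) (≈M-trans (⊕-cong ℤ.1ℤ X.M⁻¹⊙M) ⊕-I) }
    where module X = Invertible X

  diagonal : ∀ {k r′ m} → (Fin k → ℤ) → Mat (k ℕ.+ r′) (k ℕ.+ m)
  diagonal {zero}  δ i       j       = ℤ.0ℤ
  diagonal {suc k} δ zero    zero    = δ zero
  diagonal {suc k} δ zero    (suc j) = ℤ.0ℤ
  diagonal {suc k} δ (suc i) zero    = ℤ.0ℤ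
  diagonal {suc k} δ (suc i) (suc j) = diagonal {k} (δ ∘ suc) i j

  diagonal-suc : ∀ {k r′ m} (δ : Fin (suc k) → ℤ) → diagonal {suc k} {r′} {m} δ ≈M [ δ zero ]⊕ diagonal {k} (δ ∘ suc)
  diagonal-suc δ zero    zero    = refl
  diagonal-suc δ zero    (suc j) = refl
  diagonal-suc δ (suc i) zero    = refl
  diagonal-suc δ (suc i) (suc j) = refl

  record DiagonalForm {r n} (A : Mat r n) : Set where
    field
      k r′ m  : ℕ
      r≡k+r′  : r ≡ k ℕ.+ r′
      n≡k+m   : n ≡ k ℕ.+ m
      P       : Invertible (k ℕ.+ r′) r
      Q       : Invertible n (k ℕ.+ m)
      δ       : Fin k → ℤ
      δ≢0     : ∀ a → δ a ≢ ℤ.0ℤ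
      PAQ≈D   : (Invertible.M P ⊙ A) ⊙ Invertible.M Q ≈M diagonal {k} {r′} {m} δ

  pivotForm-blocks : ∀ {r n} {A : Mat (suc r) (suc n)} (pf : PivotForm A) →
                     PivotForm.B pf ≈M [ PivotForm.B pf zero zero ]⊕ (λ i j → PivotForm.B pf (suc i) (suc j))
  pivotForm-blocks pf zero    zero    = refl
  pivotForm-blocks pf zero    (suc j) = PivotForm.row≗0 pf j
  pivotForm-blocks pf (suc i) zero    = PivotForm.column≗0 pf i
  pivotForm-blocks pf (suc i) (suc j) = refl

  diagonalForm-extend : ∀ {r n} {A : Mat (suc r) (suc n)} (pf : PivotForm A) →
                        DiagonalForm (λ i j → PivotForm.B pf (suc i) (suc j)) → DiagonalForm A
  diagonalForm-extend {r} {n} {A} pf D = record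
    { k = suc D.k ; r′ = D.r′ ; m = D.m
    ; r≡k+r′ = cong suc D.r≡k+r′ ; n≡k+m = cong suc D.n≡k+m
    ; P = ⊕-invertible D.P ∘ᴵ U ; Q = V ∘ᴵ ⊕-invertible D.Q
    ; δ = δ′ ; δ≢0 = δ′≢0
    ; PAQ≈D =
        ≈M-trans (⊙-reassoc P′ (Invertible.M U) A (Invertible.M V) Q′)
        (≈M-trans (⊙-congʳ Q′ (⊙-congˡ P′ (≈M-trans UAV≈B (pivotForm-blocks pf))))
        (≈M-trans (⊙-congʳ Q′ (⊕-⊙ ℤ.1ℤ p (Invertible.M D.P) B′))
        (≈M-trans (⊕-⊙ (ℤ.1ℤ * p) ℤ.1ℤ (Invertible.M D.P ⊙ B′) (Invertible.M D.Q))
        (≈M-trans blocks (≈M-sym (diagonal-suc δ′)))))) }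
    where
    module D = DiagonalForm D
    open PivotForm pf
    p = B zero zero
    B′ : Mat r n
    B′ i j = B (suc i) (suc j)
    P′ = [ ℤ.1ℤ ]⊕ Invertible.M D.P
    Q′ = [ ℤ.1ℤ ]⊕ Invertible.M D.Q
    δ′ : Fin (suc D.k) → ℤ
    δ′ zero    = p
    δ′ (suc a) = D.δ a
    δ′≢0 : ∀ a → δ′ a ≢ ℤ.0ℤ
    δ′≢0 zero    = pivot≢0
    δ′≢0 (suc a) = D.δ≢0 a
    blocks : [ ℤ.1ℤ * p * ℤ.1ℤ ]⊕ ((Invertible.M D.P ⊙ B′) ⊙ Invertible.M D.Q) ≈M [ p ]⊕ diagonal D.δ
    blocks zero    zero    = trans (ℤP.*-identityʳ _) (ℤP.*-identityˡ p)
    blocks zero    (suc j) = refl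
    blocks (suc i) zero    = refl
    blocks (suc i) (suc j) = D.PAQ≈D i j

  diagonalForm-zero : ∀ {r n} (A : Mat r n) → (∀ i j → A i j ≡ ℤ.0ℤ) → DiagonalForm A
  diagonalForm-zero {r} {n} A A≗0 = record
    { k = 0 ; r′ = r ; m = n ; r≡k+r′ = refl ; n≡k+m = refl ; P = Invertible-id ; Q = Invertible-id
    ; δ = λ () ; δ≢0 = λ ()
    ; PAQ≈D = λ i j → trans (⊙-I (I ⊙ A) i j) (trans (I-⊙ A i j) (A≗0 i j)) }

  diagonalForm : ∀ {r n} (A : Mat r n) → DiagonalForm A
  diagonalForm {zero}          A = diagonalForm-zero A (λ ())
  diagonalForm {suc r} {zero}  A = diagonalForm-zero A (λ i ())
  diagonalForm {suc r} {suc n} A with nonzeroEntry? A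
  ... | inj₂ A≗0 = diagonalForm-zero A A≗0
  ... | inj₁ (i , j , Aᵢⱼ≢0) = diagonalForm-extend pf (diagonalForm (λ a b → PivotForm.B pf (suc a) (suc b)))
    where
    σ = swapWithZero i
    τ = swapWithZero j
    swapped : (permMatrix σ ⊙ A) ⊙ permMatrix τ ᵀ ≈M (λ x y → A (σ x) (τ y))
    swapped x y = trans (⊙-permMatrixᵀ τ (permMatrix σ ⊙ A) x y) (permMatrix-⊙ σ A x (τ y))
    pf : PivotForm A
    pf = pivotForm-transport (swapMatrix i) (Invertible-ᵀ (swapMatrix j))
           (pivotForm-resp-≈ swapped (pivotForm-descent (suc ∣ A i j ∣) _ Aᵢⱼ≢0 ℕP.≤-refl))

  diagonal-upperRow : ∀ {k r′ m} (δ : Fin k → ℤ) (a : Fin k) j → diagonal {k} {r′} {m} δ (a ↑ˡ r′) j ≡ δ a * I (a ↑ˡ m) j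
  diagonal-upperRow δ zero    zero    = sym (ℤP.*-identityʳ (δ zero))
  diagonal-upperRow δ zero    (suc j) = sym (ℤP.*-zeroʳ (δ zero))
  diagonal-upperRow δ (suc a) zero    = sym (ℤP.*-zeroʳ (δ (suc a)))
  diagonal-upperRow δ (suc a) (suc j) = diagonal-upperRow (δ ∘ suc) a j

  diagonal-lowerRow : ∀ {k r′ m} (δ : Fin k → ℤ) (l : Fin r′) j → diagonal {k} {r′} {m} δ (k ↑ʳ l) j ≡ ℤ.0ℤ
  diagonal-lowerRow {zero}  δ l j       = refl
  diagonal-lowerRow {suc k} δ l zero    = refl
  diagonal-lowerRow {suc k} δ l (suc j) = diagonal-lowerRow (δ ∘ suc) l j

  diagonal-upperColumn : ∀ {k r′ m} (δ : Fin k → ℤ) i (b : Fin k) → diagonal {k} {r′} {m} δ i (b ↑ˡ m) ≡ δ b * I (b ↑ˡ r′) i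
  diagonal-upperColumn δ zero    zero    = sym (ℤP.*-identityʳ (δ zero))
  diagonal-upperColumn δ (suc i) zero    = sym (ℤP.*-zeroʳ (δ zero))
  diagonal-upperColumn δ zero    (suc b) = sym (ℤP.*-zeroʳ (δ (suc b)))
  diagonal-upperColumn δ (suc i) (suc b) = diagonal-upperColumn (δ ∘ suc) i b

  diagonal-lowerColumn : ∀ {k r′ m} (δ : Fin k → ℤ) i (l : Fin m) → diagonal {k} {r′} {m} δ i (k ↑ʳ l) ≡ ℤ.0ℤ
  diagonal-lowerColumn {zero}  δ i       l = refl
  diagonal-lowerColumn {suc k} δ zero    l = refl
  diagonal-lowerColumn {suc k} δ (suc i) l = diagonal-lowerColumn (δ ∘ suc) i l

  diagonal-·-upper : ∀ {k r′ m} (δ : Fin k → ℤ) (y : ℤ^ (k ℕ.+ m)) a → (diagonal {k} {r′} {m} δ · y) (a ↑ˡ r′) ≡ δ a * y (a ↑ˡ m)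
  diagonal-·-upper {k} {r′} {m} δ y a =
    trans (sumℤ-cong {k ℕ.+ m} (λ j → trans (cong (_* y j) (diagonal-upperRow δ a j)) (ℤP.*-assoc (δ a) _ _)))
          (trans (sumℤ-scaleˡ (δ a) (λ j → I (a ↑ˡ m) j * y j)) (cong (δ a *_) (sum-Iˡ (a ↑ˡ m) y)))

  diagonal-·-lower : ∀ {k r′ m} (δ : Fin k → ℤ) (y : ℤ^ (k ℕ.+ m)) l → (diagonal {k} {r′} {m} δ · y) (k ↑ʳ l) ≡ ℤ.0ℤ
  diagonal-·-lower {k} {r′} {m} δ y l = sumℤ-zero {k ℕ.+ m} (λ j → trans (cong (_* y j) (diagonal-lowerRow δ l j)) (ℤP.*-zeroˡ (y j)))

  diagonalᵀ-·-upper : ∀ {k r′ m} (δ : Fin k → ℤ) (t : ℤ^ (k ℕ.+ r′)) b → (diagonal {k} {r′} {m} δ ᵀ · t) (b ↑ˡ m) ≡ δ b * t (b ↑ˡ r′)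
  diagonalᵀ-·-upper {k} {r′} {m} δ t b =
    trans (sumℤ-cong {k ℕ.+ r′} (λ i → trans (cong (_* t i) (diagonal-upperColumn δ i b)) (ℤP.*-assoc (δ b) _ _)))
          (trans (sumℤ-scaleˡ (δ b) (λ i → I (b ↑ˡ r′) i * t i)) (cong (δ b *_) (sum-Iˡ (b ↑ˡ r′) t)))

  diagonalᵀ-·-lower : ∀ {k r′ m} (δ : Fin k → ℤ) (t : ℤ^ (k ℕ.+ r′)) l → (diagonal {k} {r′} {m} δ ᵀ · t) (k ↑ʳ l) ≡ ℤ.0ℤ
  diagonalᵀ-·-lower {k} {r′} {m} δ t l = sumℤ-zero {k ℕ.+ r′} (λ i → trans (cong (_* t i) (diagonal-lowerColumn δ i l)) (ℤP.*-zeroˡ (t i)))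

  module DiagonalFormAction {r n} {A : Mat r n} (S : DiagonalForm A) where
    open DiagonalForm S public
    module P = Invertible P
    module Q = Invertible Q

    D : Mat (k ℕ.+ r′) (k ℕ.+ m)
    D = diagonal δ

    P·A·Q·y≈D·y : ∀ y → P.M · (A · (Q.M · y)) ≈V D · y
    P·A·Q·y≈D·y y =
      ≈V-trans (≈V-sym (·-congʳ P.M (⊙-· A Q.M y)))
      (≈V-trans (≈V-sym (⊙-· P.M (A ⊙ Q.M) y))
      (≈V-trans (·-cong (≈M-sym (⊙-assoc P.M A Q.M)) (λ _ → refl))
      (·-cong PAQ≈D (λ _ → refl))))

    A·Q·y≈P⁻¹·D·y : ∀ y → A · (Q.M · y) ≈V P.M⁻¹ · (D · y)
    A·Q·y≈P⁻¹·D·y y = ≈V-trans (≈V-sym (M⁻¹·M·x≈x P _)) (·-congʳ P.M⁻¹ (P·A·Q·y≈D·y y))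

    A·x≈P⁻¹·D·Q⁻¹·x : ∀ x → A · x ≈V P.M⁻¹ · (D · (Q.M⁻¹ · x))
    A·x≈P⁻¹·D·Q⁻¹·x x = ≈V-trans (·-congʳ A (≈V-sym (M·M⁻¹·x≈x Q x))) (A·Q·y≈P⁻¹·D·y (Q.M⁻¹ · x))

    P·A·y≈D·Q⁻¹·y : ∀ y → P.M · (A · y) ≈V D · (Q.M⁻¹ · y)
    P·A·y≈D·Q⁻¹·y y = ≈V-trans (·-congʳ P.M (A·x≈P⁻¹·D·Q⁻¹·x y)) (M·M⁻¹·x≈x P _)

module SquareMatrix where

  import Data.Nat.Properties as ℕP
  open import Data.Integer as ℤ using (ℤ; _*_)
  import Data.Integer.Properties as ℤP
  open import Data.Sum using (inj₁; inj₂)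
  open import Data.Empty using (⊥; ⊥-elim)
  open IntegerMatrix
  open Blocks using (split; upper; lower)
  open InvertibleMatrix using (M⁻¹·M·x≈x; M·M⁻¹·x≈x)
  open DiagonalForm

  i*j≢0 : ∀ {i j} → i ≢ ℤ.0ℤ → j ≢ ℤ.0ℤ → i * j ≢ ℤ.0ℤ
  i*j≢0 {i} i≢0 j≢0 ij≡0 with ℤP.i*j≡0⇒i≡0∨j≡0 i ij≡0
  ... | inj₁ i≡0 = i≢0 i≡0
  ... | inj₂ j≡0 = j≢0 j≡0

  i*j≡0⇒j≡0 : ∀ {i j} → i ≢ ℤ.0ℤ → i * j ≡ ℤ.0ℤ → j ≡ ℤ.0ℤ
  i*j≡0⇒j≡0 {i} i≢0 ij≡0 with ℤP.i*j≡0⇒i≡0∨j≡0 i ij≡0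
  ... | inj₁ i≡0 = ⊥-elim (i≢0 i≡0)
  ... | inj₂ j≡0 = j≡0

  record CommonMultiple {k} (δ : Fin k → ℤ) : Set where
    field
      N         : ℤ
      N≢0       : N ≢ ℤ.0ℤ
      cofactor  : Fin k → ℤ
      cofactor* : ∀ a → cofactor a * δ a ≡ N

  commonMultiple : ∀ {k} (δ : Fin k → ℤ) → (∀ a → δ a ≢ ℤ.0ℤ) → CommonMultiple δ
  commonMultiple {zero}  δ δ≢0 = record { N = ℤ.1ℤ ; N≢0 = λ () ; cofactor = λ () ; cofactor* = λ () }
  commonMultiple {suc k} δ δ≢0 = record
    { N = δ zero * C.N ; N≢0 = i*j≢0 (δ≢0 zero) C.N≢0 ; cofactor = c ; cofactor* = c* }
    where
    module C = CommonMultiple (commonMultiple (δ ∘ suc) (δ≢0 ∘ suc))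
    c : Fin (suc k) → ℤ
    c zero    = C.N
    c (suc a) = δ zero * C.cofactor a
    c* : ∀ a → c a * δ a ≡ δ zero * C.N
    c* zero    = ℤP.*-comm C.N (δ zero)
    c* (suc a) = trans (ℤP.*-assoc (δ zero) (C.cofactor a) _) (cong (δ zero *_) (C.cofactor* a))

  InjectiveMat : ∀ {p q} → Mat p q → Set
  InjectiveMat G = ∀ x → IsZeroV (G · x) → IsZeroV x

  -- Adj plays the role of N G⁻¹ (an adjugate), avoiding rational matrices.
  record PseudoInverse {m} (G : Mat m m) : Set where
    field
      N     : ℤ
      N≢0   : N ≢ ℤ.0ℤ
      Adj   : Mat m m
      G·Adj : ∀ x → G · (Adj · x) ≈V N *V x
      Adj·G : ∀ x → Adj · (G · x) ≈V N *V x

  -- Injectivity leaves no zero column in P G Q = diag(δ), so diag(δ) is square and Adj = Q diag(N / δ) P.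
  pseudoInverse : ∀ {s} (G : Mat s s) → InjectiveMat G → PseudoInverse G
  pseudoInverse {s} G G-injective = record { N = C.N ; N≢0 = C.N≢0 ; Adj = Adj ; G·Adj = G·Adj ; Adj·G = Adj·G }
    where
    open DiagonalFormAction (diagonalForm G)
    module C = CommonMultiple (commonMultiple δ δ≢0)
    E : Mat (k ℕ.+ m) (k ℕ.+ r′)
    E = diagonal {k} {m} {r′} C.cofactor
    Adj : Mat s s
    Adj = (Q.M ⊙ E) ⊙ P.M

    no-lower-column : Fin m → ⊥
    no-lower-column l = 1≢0 (trans (sym (I-diag (k ↑ʳ l))) (basis≗0 (k ↑ʳ l)))
      where
      x = Q.M · basis (k ↑ʳ l)
      Gx≗0 : IsZeroV (G · x)
      Gx≗0 = ≈V-trans (A·Q·y≈P⁻¹·D·y (basis (k ↑ʳ l)))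
               (·-zero P.M⁻¹ (≈V-trans (·-basis D (k ↑ʳ l)) (λ j → diagonal-lowerColumn δ j l)))
      basis≗0 : IsZeroV (basis (k ↑ʳ l))
      basis≗0 = ≈V-trans (≈V-sym (M⁻¹·M·x≈x Q (basis (k ↑ʳ l)))) (·-zero Q.M⁻¹ (G-injective x Gx≗0))
      1≢0 : ℤ.1ℤ ≢ ℤ.0ℤ
      1≢0 ()

    no-lower-row : Fin r′ → ⊥
    no-lower-row l = no-lower-column (subst Fin (ℕP.+-cancelˡ-≡ k _ _ (trans (sym r≡k+r′) n≡k+m)) l)

    E·D·y : ∀ y → E · (D · y) ≈V C.N *V y
    E·D·y y i with split k m i
    ... | upper a = begin
      (E · (D · y)) (a ↑ˡ m)          ≡⟨ diagonal-·-upper C.cofactor (D · y) a ⟩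
      C.cofactor a * (D · y) (a ↑ˡ r′) ≡⟨ cong (C.cofactor a *_) (diagonal-·-upper δ y a) ⟩
      C.cofactor a * (δ a * y (a ↑ˡ m)) ≡⟨ ℤP.*-assoc (C.cofactor a) (δ a) _ ⟨
      C.cofactor a * δ a * y (a ↑ˡ m)   ≡⟨ cong (_* y (a ↑ˡ m)) (C.cofactor* a) ⟩
      C.N * y (a ↑ˡ m)                  ∎
      where open ≡-Reasoning
    ... | lower l = ⊥-elim (no-lower-column l)

    D·E·z : ∀ z → D · (E · z) ≈V C.N *V z
    D·E·z z i with split k r′ i
    ... | upper a = begin
      (D · (E · z)) (a ↑ˡ r′)           ≡⟨ diagonal-·-upper δ (E · z) a ⟩
      δ a * (E · z) (a ↑ˡ m)            ≡⟨ cong (δ a *_) (diagonal-·-upper C.cofactor z a) ⟩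
      δ a * (C.cofactor a * z (a ↑ˡ r′)) ≡⟨ ℤP.*-assoc (δ a) (C.cofactor a) _ ⟨
      δ a * C.cofactor a * z (a ↑ˡ r′)   ≡⟨ cong (_* z (a ↑ˡ r′)) (trans (ℤP.*-comm (δ a) (C.cofactor a)) (C.cofactor* a)) ⟩
      C.N * z (a ↑ˡ r′)                  ∎
      where open ≡-Reasoning
    ... | lower l = ⊥-elim (no-lower-row l)

    Adj·x : ∀ x → Adj · x ≈V Q.M · (E · (P.M · x))
    Adj·x x = ≈V-trans (⊙-· (Q.M ⊙ E) P.M x) (⊙-· Q.M E (P.M · x))

    G·Adj : ∀ x → G · (Adj · x) ≈V C.N *V x
    G·Adj x = ≈V-trans (·-congʳ G (Adj·x x))
              (≈V-trans (A·Q·y≈P⁻¹·D·y (E · (P.M · x)))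
              (≈V-trans (·-congʳ P.M⁻¹ (D·E·z (P.M · x)))
              (≈V-trans (·-scale P.M⁻¹ C.N (P.M · x))
              (λ i → cong (C.N *_) (M⁻¹·M·x≈x P x i)))))

    Adj·G : ∀ x → Adj · (G · x) ≈V C.N *V x
    Adj·G x = ≈V-trans (Adj·x (G · x))
              (≈V-trans (·-congʳ Q.M (·-congʳ E (P·A·y≈D·Q⁻¹·y x)))
              (≈V-trans (·-congʳ Q.M (E·D·y (Q.M⁻¹ · x)))
              (≈V-trans (·-scale Q.M C.N (Q.M⁻¹ · x))
              (λ i → cong (C.N *_) (M·M⁻¹·x≈x Q x i)))))

module RationalVector where

  open import Algebra.Bundles using (CommutativeRing)
  open import Data.Nat.Divisibility using (∣1⇒≡1)
  open import Data.Integer as ℤ using (ℤ) renaming (_*_ to _*ℤ_)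
  open import Data.Integer.Tactic.RingSolver using (solve-∀)
  open import Data.Rational as ℚ using (ℚ; mkℚ; 0ℚ; 1ℚ; 1/_; _≤_; _+_; _*_; -_; _-_)
  import Data.Rational.Properties as ℚP
  import Data.Rational.Unnormalised as ℚᵘ
  import Data.Rational.Unnormalised.Properties as ℚᵘP
  open import Algebra.Properties.CommutativeSemigroup (CommutativeRing.*-commutativeSemigroup ℚP.+-*-commutativeRing)
    using (xy∙z≈xz∙y)
  open import Algebra.Properties.Ring ℚP.+-*-ring using (x[y-z]≈xy-xz)
  open import Data.Sum using (inj₁; inj₂)
  open import Relation.Nullary using (yes; no)
  open IntegerMatrix using (dot)

  open FinSum ℚP.+-*-isCommutativeRing sumℚ (λ _ → refl) (λ _ → refl) public
    renaming ( S-cong to sumℚ-cong; S-zero to sumℚ-zero; S-distrib-+ to sumℚ-distrib-+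
             ; S-distrib-- to sumℚ-distrib--; S-scaleˡ to sumℚ-scaleˡ; S-scaleʳ to sumℚ-scaleʳ
             ; S-comm to sumℚ-comm)
    hiding (S-neg; S-split)

  toℚ≡mkℚ : ∀ z → toℚ z ≡ mkℚ z 0 (λ {d} → ∣1⇒≡1 ∘ proj₂)
  toℚ≡mkℚ z = ℚP.↥p/↧p≡p (mkℚ z 0 (λ {d} → ∣1⇒≡1 ∘ proj₂))

  toℚᵘ-toℚ : ∀ z → ℚ.toℚᵘ (toℚ z) ≡ ℚᵘ.mkℚᵘ z 0
  toℚᵘ-toℚ z = cong ℚ.toℚᵘ (toℚ≡mkℚ z)

  toℚ-injective : ∀ {a b} → toℚ a ≡ toℚ b → a ≡ b
  toℚ-injective {a} {b} eq = cong ℚ.numerator (trans (sym (toℚ≡mkℚ a)) (trans eq (toℚ≡mkℚ b)))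

  toℚ-+ : ∀ a b → toℚ (a ℤ.+ b) ≡ toℚ a + toℚ b
  toℚ-+ a b = ℚP.toℚᵘ-injective
    (ℚᵘP.≃-trans (ℚᵘP.≃-reflexive (toℚᵘ-toℚ (a ℤ.+ b)))
    (ℚᵘP.≃-trans (ℚᵘ.*≡* (cross a b))
    (ℚᵘP.≃-trans (ℚᵘP.≃-reflexive (sym (cong₂ ℚᵘ._+_ (toℚᵘ-toℚ a) (toℚᵘ-toℚ b))))
    (ℚᵘP.≃-sym (ℚP.toℚᵘ-homo-+ (toℚ a) (toℚ b))))))
    where cross : ∀ a b → (a ℤ.+ b) ℤ.* (ℤ.1ℤ ℤ.* ℤ.1ℤ) ≡ (a ℤ.* ℤ.1ℤ ℤ.+ b ℤ.* ℤ.1ℤ) ℤ.* ℤ.1ℤ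
          cross = solve-∀

  toℚ-* : ∀ a b → toℚ (a ℤ.* b) ≡ toℚ a * toℚ b
  toℚ-* a b = ℚP.toℚᵘ-injective
    (ℚᵘP.≃-trans (ℚᵘP.≃-reflexive (toℚᵘ-toℚ (a ℤ.* b)))
    (ℚᵘP.≃-trans (ℚᵘ.*≡* (cross a b))
    (ℚᵘP.≃-trans (ℚᵘP.≃-reflexive (sym (cong₂ ℚᵘ._*_ (toℚᵘ-toℚ a) (toℚᵘ-toℚ b))))
    (ℚᵘP.≃-sym (ℚP.toℚᵘ-homo-* (toℚ a) (toℚ b))))))
    where cross : ∀ a b → (a ℤ.* b) ℤ.* (ℤ.1ℤ ℤ.* ℤ.1ℤ) ≡ (a ℤ.* b) ℤ.* ℤ.1ℤ
          cross = solve-∀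

  toℚ-neg : ∀ a → toℚ (ℤ.- a) ≡ - toℚ a
  toℚ-neg a = ℚP.toℚᵘ-injective
    (ℚᵘP.≃-trans (ℚᵘP.≃-reflexive (toℚᵘ-toℚ (ℤ.- a)))
    (ℚᵘP.≃-trans (ℚᵘP.≃-reflexive (sym (cong ℚᵘ.-_ (toℚᵘ-toℚ a))))
    (ℚᵘP.≃-sym (ℚP.toℚᵘ-homo‿- (toℚ a)))))

  toℚ-- : ∀ a b → toℚ (a ℤ.- b) ≡ toℚ a - toℚ b
  toℚ-- a b = trans (toℚ-+ a (ℤ.- b)) (cong (toℚ a +_) (toℚ-neg b))

  toℚ-sum : ∀ {n} (f : Fin n → ℤ) → toℚ (sumℤ f) ≡ sumℚ (toℚ ∘ f)
  toℚ-sum {zero}  f = refl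
  toℚ-sum {suc n} f = trans (toℚ-+ (f zero) _) (cong (toℚ (f zero) +_) (toℚ-sum (f ∘ suc)))

  toℚ-dot : ∀ {n} (x y : ℤ^ n) → toℚ (dot x y) ≡ ⟨ embed x , embed y ⟩
  toℚ-dot x y = trans (toℚ-sum (λ i → x i ℤ.* y i)) (sumℚ-cong (λ i → toℚ-* (x i) (y i)))

  x*x≥0 : ∀ x → 0ℚ ≤ x * x
  x*x≥0 x with ℚP.≤-total 0ℚ x
  ... | inj₁ 0≤x = ℚP.nonNegative⁻¹ (x * x) {{ℚP.nonNeg*nonNeg⇒nonNeg x {{ℚ.nonNegative 0≤x}} x {{ℚ.nonNegative 0≤x}}}}
  ... | inj₂ x≤0 = ℚP.nonNegative⁻¹ (x * x) {{ℚP.nonPos*nonPos⇒nonPos x {{ℚ.nonPositive x≤0}} x {{ℚ.nonPositive x≤0}}}}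

  x*x≡0⇒x≡0 : ∀ x → x * x ≡ 0ℚ → x ≡ 0ℚ
  x*x≡0⇒x≡0 x x*x≡0 with x ℚP.≟ 0ℚ
  ... | yes x≡0 = x≡0
  ... | no  x≢0 = begin
    x              ≡⟨ ℚP.*-identityʳ x ⟨
    x * 1ℚ         ≡⟨ cong (x *_) (ℚP.*-inverseʳ x) ⟨
    x * (x * x⁻¹)  ≡⟨ ℚP.*-assoc x x x⁻¹ ⟨
    (x * x) * x⁻¹  ≡⟨ cong (_* x⁻¹) x*x≡0 ⟩
    0ℚ * x⁻¹       ≡⟨ ℚP.*-zeroˡ x⁻¹ ⟩
    0ℚ             ∎
    where
    open ≡-Reasoning
    instance _ = ℚ.≢-nonZero x≢0
    x⁻¹ = 1/ x

  sum-squares≥0 : ∀ {n} (x : ℚ^ n) → 0ℚ ≤ ⟨ x , x ⟩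
  sum-squares≥0 {zero}  x = ℚP.≤-refl
  sum-squares≥0 {suc n} x = subst (_≤ ⟨ x , x ⟩) (ℚP.+-identityˡ 0ℚ) (ℚP.+-mono-≤ (x*x≥0 (x zero)) (sum-squares≥0 (x ∘ suc)))

  x+y≡0⇒x≡0 : ∀ {x y} → 0ℚ ≤ x → 0ℚ ≤ y → x + y ≡ 0ℚ → x ≡ 0ℚ
  x+y≡0⇒x≡0 {x} 0≤x 0≤y x+y≡0 = ℚP.≤-antisym (subst₂ _≤_ (ℚP.+-identityʳ x) x+y≡0 (ℚP.+-monoʳ-≤ x 0≤y)) 0≤x

  x+y≡0⇒y≡0 : ∀ {x y} → 0ℚ ≤ x → 0ℚ ≤ y → x + y ≡ 0ℚ → y ≡ 0ℚ
  x+y≡0⇒y≡0 {x} {y} 0≤x 0≤y x+y≡0 = x+y≡0⇒x≡0 0≤y 0≤x (trans (ℚP.+-comm y x) x+y≡0)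

  sum-squares≡0 : ∀ {n} (x : ℚ^ n) → ⟨ x , x ⟩ ≡ 0ℚ → ∀ i → x i ≡ 0ℚ
  sum-squares≡0 {suc n} x ⟨x,x⟩≡0 zero    = x*x≡0⇒x≡0 (x zero) (x+y≡0⇒x≡0 (x*x≥0 (x zero)) (sum-squares≥0 (x ∘ suc)) ⟨x,x⟩≡0)
  sum-squares≡0 {suc n} x ⟨x,x⟩≡0 (suc i) = sum-squares≡0 (x ∘ suc) (x+y≡0⇒y≡0 (x*x≥0 (x zero)) (sum-squares≥0 (x ∘ suc)) ⟨x,x⟩≡0) i

  ⟨⟩-comm : ∀ {k} (x y : ℚ^ k) → ⟨ x , y ⟩ ≡ ⟨ y , x ⟩
  ⟨⟩-comm x y = sumℚ-cong (λ i → ℚP.*-comm (x i) (y i))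

  ⟨⟩-congʳ : ∀ {k} (z : ℚ^ k) {x y : ℚ^ k} → (∀ i → x i ≡ y i) → ⟨ z , x ⟩ ≡ ⟨ z , y ⟩
  ⟨⟩-congʳ z x≗y = sumℚ-cong (λ i → cong (z i *_) (x≗y i))

  ⟨⟩-distrib-- : ∀ {k} (z x y : ℚ^ k) → ⟨ z , x -Q y ⟩ ≡ ⟨ z , x ⟩ - ⟨ z , y ⟩
  ⟨⟩-distrib-- {k} z x y = trans (sumℚ-cong (λ i → x[y-z]≈xy-xz (z i) (x i) (y i))) (sumℚ-distrib-- {k} _ _)

  ⟨⟩-scaled : ∀ {k} (z w : ℤ^ k) (c : ℚ) → ⟨ (λ i → toℚ (z i) * c) , embed w ⟩ ≡ toℚ (dot z w) * c
  ⟨⟩-scaled z w c = begin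
    sumℚ (λ i → toℚ (z i) * c * toℚ (w i))   ≡⟨ sumℚ-cong (λ i → xy∙z≈xz∙y (toℚ (z i)) c (toℚ (w i))) ⟩
    sumℚ (λ i → toℚ (z i) * toℚ (w i) * c)   ≡⟨ sumℚ-scaleʳ c (λ i → toℚ (z i) * toℚ (w i)) ⟩
    ⟨ embed z , embed w ⟩ * c                ≡⟨ cong (_* c) (toℚ-dot z w) ⟨
    toℚ (dot z w) * c                        ∎
    where open ≡-Reasoning

  ⟨⟩-· : ∀ {p m} (u : ℚ^ p) (B : Mat p m) t → ⟨ u , embed (B · t) ⟩ ≡ sumℚ (λ j → toℚ (t j) * ⟨ u , embed (λ i → B i j) ⟩)
  ⟨⟩-· {m = m} u B t = begin
    sumℚ (λ i → u i * toℚ (sumℤ (λ j → B i j *ℤ t j)))          ≡⟨ sumℚ-cong (λ i → cong (u i *_) (trans (toℚ-sum (λ j → B i j *ℤ t j)) (sumℚ-cong {m} (λ j → toℚ-* (B i j) (t j))))) ⟩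
    sumℚ (λ i → u i * sumℚ (λ j → toℚ (B i j) * toℚ (t j)))     ≡⟨ sumℚ-cong (λ i → sym (sumℚ-scaleˡ (u i) (λ j → toℚ (B i j) * toℚ (t j)))) ⟩
    sumℚ (λ i → sumℚ (λ j → u i * (toℚ (B i j) * toℚ (t j))))   ≡⟨ sumℚ-comm (λ i j → u i * (toℚ (B i j) * toℚ (t j))) ⟩
    sumℚ (λ j → sumℚ (λ i → u i * (toℚ (B i j) * toℚ (t j))))   ≡⟨ sumℚ-cong (λ j → trans (sumℚ-cong (λ i → reorder (u i) (toℚ (B i j)) (toℚ (t j)))) (sumℚ-scaleˡ (toℚ (t j)) (λ i → u i * toℚ (B i j)))) ⟩
    sumℚ (λ j → toℚ (t j) * ⟨ u , embed (λ i → B i j) ⟩)         ∎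
    where
    open ≡-Reasoning
    reorder : ∀ a b x → a * (b * x) ≡ x * (a * b)
    reorder a b x = trans (sym (ℚP.*-assoc a b x)) (ℚP.*-comm _ x)

  dot-self≡0 : ∀ {n} (y : ℤ^ n) → dot y y ≡ ℤ.0ℤ → IsZeroV y
  dot-self≡0 y y·y≡0 i = toℚ-injective (sum-squares≡0 (embed y) (trans (sym (toℚ-dot y y)) (cong toℚ y·y≡0)) i)

module FlowLattice {d : ℕ} (Σc : CWChainComplex d) where

  open import Algebra.Bundles using (CommutativeRing)
  open import Data.Integer as ℤ using (ℤ)
  import Data.Integer.Properties as ℤP
  open import Data.Rational as ℚ using (ℚ; 0ℚ; 1ℚ; 1/_; _+_; _*_; _-_)
  import Data.Rational.Properties as ℚP
  open import Algebra.Properties.CommutativeSemigroup (CommutativeRing.*-commutativeSemigroup ℚP.+-*-commutativeRing)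
    using (x∙yz≈y∙xz; xy∙z≈xz∙y)
  open import Algebra.Properties.Ring ℚP.+-*-ring using ([y-z]x≈yx-zx)
  open IntegerMatrix
  open SquareMatrix using (PseudoInverse; pseudoInverse)
  open RationalVector

  n : ℕ
  n = facets Σc

  ∂ : Mat (CWChainComplex.rank Σc d) n
  ∂ = ∂d Σc

  orthogonal-to-flows : ∀ (z v : ℚ^ n) → InFlowSpan Σc v → (∀ w → InFlow Σc w → ⟨ z , embed w ⟩ ≡ 0ℚ) → ⟨ z , v ⟩ ≡ 0ℚ
  orthogonal-to-flows z v (m , a , w , w-flow , v≡∑aw) z⊥flows = begin
    ⟨ z , v ⟩                                              ≡⟨ ⟨⟩-congʳ z v≡∑aw ⟩
    sumℚ (λ i → z i * sumℚ (λ j → a j * toℚ (w j i)))     ≡⟨ sumℚ-cong (λ i → sym (sumℚ-scaleˡ (z i) (λ j → a j * toℚ (w j i)))) ⟩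
    sumℚ (λ i → sumℚ (λ j → z i * (a j * toℚ (w j i))))   ≡⟨ sumℚ-comm (λ i j → z i * (a j * toℚ (w j i))) ⟩
    sumℚ (λ j → sumℚ (λ i → z i * (a j * toℚ (w j i))))   ≡⟨ sumℚ-cong (λ j → trans (sumℚ-cong (λ i → x∙yz≈y∙xz (z i) (a j) (toℚ (w j i)))) (sumℚ-scaleˡ (a j) (λ i → z i * toℚ (w j i)))) ⟩
    sumℚ (λ j → a j * ⟨ z , embed (w j) ⟩)                 ≡⟨ sumℚ-zero (λ j → trans (cong (a j *_) (z⊥flows (w j) (w-flow j))) (ℚP.*-zeroʳ (a j))) ⟩
    0ℚ                                                      ∎
    where open ≡-Reasoning

  record FlowBasis : Set where
    field
      m         : ℕ
      B         : Mat n m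
      B-flow    : ∀ x → InFlow Σc (B · x)
      B-inj     : ∀ x → IsZeroV (B · x) → IsZeroV x
      B-spans   : ∀ v → InFlow Σc v → ∃[ x ] (v ≈V B · x)

  -- dual x = B G⁻¹ x for the Gram matrix G = BᵀB, computed as B (Adj x) / N.
  module Dual (β : FlowBasis) where
    open FlowBasis β public

    G : Mat m m
    G = B ᵀ ⊙ B

    G·x≈Bᵀ·B·x : ∀ x → G · x ≈V B ᵀ · (B · x)
    G·x≈Bᵀ·B·x = ⊙-· (B ᵀ) B

    G-injective : ∀ x → IsZeroV (G · x) → IsZeroV x
    G-injective x Gx≗0 = B-inj x (dot-self≡0 (B · x) (begin
      dot (B · x) (B · x)   ≡⟨ dot-adjoint (B ᵀ) x (B · x) ⟩
      dot x (B ᵀ · (B · x)) ≡⟨ dot-congʳ x (G·x≈Bᵀ·B·x x) ⟨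
      dot x (G · x)         ≡⟨ dot-zeroʳ x Gx≗0 ⟩
      ℤ.0ℤ                  ∎))
      where open ≡-Reasoning

    G-symmetric : ∀ x y → dot (G · x) y ≡ dot x (G · y)
    G-symmetric x y = begin
      dot (G · x) y                ≡⟨ dot-congˡ y (G·x≈Bᵀ·B·x x) ⟩
      dot (B ᵀ · (B · x)) y        ≡⟨ dot-adjoint B (B · x) y ⟩
      dot (B · x) (B · y)          ≡⟨ dot-comm (B · x) (B · y) ⟩
      dot (B · y) (B · x)          ≡⟨ dot-adjoint B (B · y) x ⟨
      dot (B ᵀ · (B · y)) x        ≡⟨ dot-comm _ x ⟩
      dot x (B ᵀ · (B · y))        ≡⟨ dot-congʳ x (G·x≈Bᵀ·B·x y) ⟨
      dot x (G · y)                ∎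
      where open ≡-Reasoning

    open PseudoInverse (pseudoInverse G G-injective) public

    instance _ = ℚ.≢-nonZero (N≢0 ∘ toℚ-injective)

    N⁻¹ : ℚ
    N⁻¹ = 1/ toℚ N

    cancel-N : ∀ z → toℚ (N ℤ.* z) * N⁻¹ ≡ toℚ z
    cancel-N z = begin
      toℚ (N ℤ.* z) * N⁻¹     ≡⟨ cong (_* N⁻¹) (trans (toℚ-* N z) (ℚP.*-comm (toℚ N) (toℚ z))) ⟩
      toℚ z * toℚ N * N⁻¹     ≡⟨ ℚP.*-assoc (toℚ z) (toℚ N) N⁻¹ ⟩
      toℚ z * (toℚ N * N⁻¹)   ≡⟨ cong (toℚ z *_) (ℚP.*-inverseʳ (toℚ N)) ⟩
      toℚ z * 1ℚ              ≡⟨ ℚP.*-identityʳ _ ⟩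
      toℚ z                   ∎
      where open ≡-Reasoning

    column-flow : ∀ j → InFlow Σc (λ i → B i j)
    column-flow j i = trans (·-congʳ ∂ (≈V-sym (·-basis B j)) i) (B-flow (basis j) i)

    dual : ℤ^ m → ℚ^ n
    dual x i = sumℚ (λ j → toℚ ((Adj · x) j) * N⁻¹ * toℚ (B i j))

    dual-eval : ∀ x i → dual x i ≡ toℚ ((B · (Adj · x)) i) * N⁻¹
    dual-eval x i = begin
      sumℚ (λ j → toℚ ((Adj · x) j) * N⁻¹ * toℚ (B i j))  ≡⟨ sumℚ-cong term ⟩
      sumℚ (λ j → toℚ (B i j ℤ.* (Adj · x) j) * N⁻¹)       ≡⟨ sumℚ-scaleʳ N⁻¹ (λ j → toℚ (B i j ℤ.* (Adj · x) j)) ⟩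
      sumℚ (λ j → toℚ (B i j ℤ.* (Adj · x) j)) * N⁻¹       ≡⟨ cong (_* N⁻¹) (toℚ-sum (λ j → B i j ℤ.* (Adj · x) j)) ⟨
      toℚ ((B · (Adj · x)) i) * N⁻¹                       ∎
      where
      open ≡-Reasoning
      term : ∀ j → toℚ ((Adj · x) j) * N⁻¹ * toℚ (B i j) ≡ toℚ (B i j ℤ.* (Adj · x) j) * N⁻¹
      term j = begin
        toℚ ((Adj · x) j) * N⁻¹ * toℚ (B i j)  ≡⟨ xy∙z≈xz∙y (toℚ ((Adj · x) j)) N⁻¹ (toℚ (B i j)) ⟩
        toℚ ((Adj · x) j) * toℚ (B i j) * N⁻¹  ≡⟨ cong (_* N⁻¹) (ℚP.*-comm (toℚ ((Adj · x) j)) (toℚ (B i j))) ⟩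
        toℚ (B i j) * toℚ ((Adj · x) j) * N⁻¹  ≡⟨ cong (_* N⁻¹) (toℚ-* (B i j) ((Adj · x) j)) ⟨
        toℚ (B i j ℤ.* (Adj · x) j) * N⁻¹      ∎

    dual-cong : ∀ {x x′} → x ≈V x′ → ∀ i → dual x i ≡ dual x′ i
    dual-cong x≈x′ i = sumℚ-cong (λ j → cong (λ z → toℚ z * N⁻¹ * toℚ (B i j)) (·-congʳ Adj x≈x′ j))

    dual-span : ∀ x → InFlowSpan Σc (dual x)
    dual-span x = m , (λ j → toℚ ((Adj · x) j) * N⁻¹) , (λ j i → B i j) , column-flow , (λ i → refl)

    ⟨dual,B·t⟩ : ∀ x t → ⟨ dual x , embed (B · t) ⟩ ≡ toℚ (dot x t)
    ⟨dual,B·t⟩ x t = begin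
      ⟨ dual x , embed (B · t) ⟩                         ≡⟨ sumℚ-cong (λ i → cong (_* toℚ ((B · t) i)) (dual-eval x i)) ⟩
      ⟨ (λ i → toℚ ((B · (Adj · x)) i) * N⁻¹) , embed (B · t) ⟩ ≡⟨ ⟨⟩-scaled (B · (Adj · x)) (B · t) N⁻¹ ⟩
      toℚ (dot (B · (Adj · x)) (B · t)) * N⁻¹            ≡⟨ cong (λ z → toℚ z * N⁻¹) gram ⟩
      toℚ (N ℤ.* dot x t) * N⁻¹                          ≡⟨ cancel-N (dot x t) ⟩
      toℚ (dot x t)                                      ∎
      where
      open ≡-Reasoning
      gram : dot (B · (Adj · x)) (B · t) ≡ N ℤ.* dot x t
      gram = begin
        dot (B · (Adj · x)) (B · t)      ≡⟨ dot-adjoint (B ᵀ) (Adj · x) (B · t) ⟩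
        dot (Adj · x) (B ᵀ · (B · t))    ≡⟨ dot-congʳ (Adj · x) (G·x≈Bᵀ·B·x t) ⟨
        dot (Adj · x) (G · t)            ≡⟨ G-symmetric (Adj · x) t ⟨
        dot (G · (Adj · x)) t            ≡⟨ dot-congˡ t (G·Adj x) ⟩
        dot (N *V x) t                   ≡⟨ dot-comm (N *V x) t ⟩
        dot t (N *V x)                   ≡⟨ dot-scaleʳ t N x ⟩
        N ℤ.* dot t x                    ≡⟨ cong (N ℤ.*_) (dot-comm t x) ⟩
        N ℤ.* dot x t                    ∎

    dual-sharp : ∀ x → InFlowSharp Σc (dual x)
    dual-sharp x = dual-span x , integral
      where
      integral : ∀ w → InFlow Σc w → ∃[ z ] (⟨ dual x , embed w ⟩ ≡ toℚ z)
      integral w w-flow with B-spans w w-flow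
      ... | t , w≈Bt = dot x t , trans (⟨⟩-congʳ (dual x) (λ i → cong toℚ (w≈Bt i))) (⟨dual,B·t⟩ x t)

    dual-G : ∀ z i → dual (G · z) i ≡ toℚ ((B · z) i)
    dual-G z i = begin
      dual (G · z) i                            ≡⟨ dual-eval (G · z) i ⟩
      toℚ ((B · (Adj · (G · z))) i) * N⁻¹       ≡⟨ cong (λ u → toℚ u * N⁻¹) (trans (·-congʳ B (Adj·G z) i) (·-scale B N z i)) ⟩
      toℚ (N ℤ.* (B · z) i) * N⁻¹               ≡⟨ cancel-N ((B · z) i) ⟩
      toℚ ((B · z) i)                           ∎
      where open ≡-Reasoning

    dual-+ : ∀ x x′ i → dual (x +V x′) i ≡ dual x i + dual x′ i
    dual-+ x x′ i = begin
      dual (x +V x′) i                                              ≡⟨ dual-eval (x +V x′) i ⟩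
      toℚ ((B · (Adj · (x +V x′))) i) * N⁻¹                         ≡⟨ cong (λ u → toℚ u * N⁻¹) (trans (·-congʳ B (·-distrib-+ Adj x x′) i) (·-distrib-+ B (Adj · x) (Adj · x′) i)) ⟩
      toℚ ((B · (Adj · x)) i ℤ.+ (B · (Adj · x′)) i) * N⁻¹          ≡⟨ cong (_* N⁻¹) (toℚ-+ ((B · (Adj · x)) i) ((B · (Adj · x′)) i)) ⟩
      (toℚ ((B · (Adj · x)) i) + toℚ ((B · (Adj · x′)) i)) * N⁻¹    ≡⟨ ℚP.*-distribʳ-+ N⁻¹ (toℚ ((B · (Adj · x)) i)) (toℚ ((B · (Adj · x′)) i)) ⟩
      toℚ ((B · (Adj · x)) i) * N⁻¹ + toℚ ((B · (Adj · x′)) i) * N⁻¹ ≡⟨ cong₂ _+_ (dual-eval x i) (dual-eval x′ i) ⟨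
      dual x i + dual x′ i                                           ∎
      where open ≡-Reasoning

    dual-- : ∀ x x′ i → dual (x -V x′) i ≡ dual x i - dual x′ i
    dual-- x x′ i = begin
      dual (x -V x′) i                                              ≡⟨ dual-eval (x -V x′) i ⟩
      toℚ ((B · (Adj · (x -V x′))) i) * N⁻¹                         ≡⟨ cong (λ u → toℚ u * N⁻¹) (trans (·-congʳ B (·-distrib-- Adj x x′) i) (·-distrib-- B (Adj · x) (Adj · x′) i)) ⟩
      toℚ ((B · (Adj · x)) i ℤ.- (B · (Adj · x′)) i) * N⁻¹          ≡⟨ cong (_* N⁻¹) (toℚ-- ((B · (Adj · x)) i) ((B · (Adj · x′)) i)) ⟩
      (toℚ ((B · (Adj · x)) i) - toℚ ((B · (Adj · x′)) i)) * N⁻¹    ≡⟨ [y-z]x≈yx-zx N⁻¹ (toℚ ((B · (Adj · x)) i)) (toℚ ((B · (Adj · x′)) i)) ⟩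
      toℚ ((B · (Adj · x)) i) * N⁻¹ - toℚ ((B · (Adj · x′)) i) * N⁻¹ ≡⟨ cong₂ _-_ (dual-eval x i) (dual-eval x′ i) ⟨
      dual x i - dual x′ i                                           ∎
      where open ≡-Reasoning

    dual-kernel : ∀ x x′ f → InFlow Σc f → (∀ i → dual x i - dual x′ i ≡ toℚ (f i)) → ∃[ t ] ((x -V x′) ≈V G · t)
    dual-kernel x x′ f f-flow dual≡f with B-spans f f-flow
    ... | t , f≈Bt = t , λ i → ℤP.*-cancelˡ-≡ N _ _ {{ℤ.≢-nonZero N≢0}} (begin
      N ℤ.* (x -V x′) i        ≡⟨ G·Adj (x -V x′) i ⟨
      (G · y) i                ≡⟨ ·-congʳ G y≈Nt i ⟩
      (G · (N *V t)) i         ≡⟨ ·-scale G N t i ⟩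
      N ℤ.* (G · t) i          ∎)
      where
      open ≡-Reasoning
      y = Adj · (x -V x′)
      By≈NBt : ∀ i → (B · y) i ≡ N ℤ.* (B · t) i
      By≈NBt i = toℚ-injective (begin
        toℚ ((B · y) i)                    ≡⟨ cancel-N ((B · y) i) ⟨
        toℚ (N ℤ.* (B · y) i) * N⁻¹       ≡⟨ cong (_* N⁻¹) (trans (toℚ-* N _) (ℚP.*-comm (toℚ N) _)) ⟩
        toℚ ((B · y) i) * toℚ N * N⁻¹      ≡⟨ xy∙z≈xz∙y (toℚ ((B · y) i)) (toℚ N) N⁻¹ ⟩
        toℚ ((B · y) i) * N⁻¹ * toℚ N      ≡⟨ cong (_* toℚ N) (trans (sym (dual-eval (x -V x′) i)) (trans (dual-- x x′ i) (trans (dual≡f i) (cong toℚ (f≈Bt i))))) ⟩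
        toℚ ((B · t) i) * toℚ N            ≡⟨ trans (sym (toℚ-* ((B · t) i) N)) (cong toℚ (ℤP.*-comm ((B · t) i) N)) ⟩
        toℚ (N ℤ.* (B · t) i)              ∎)
      y≈Nt : y ≈V N *V t
      y≈Nt j = ℤP.i-j≡0⇒i≡j _ _ (B-inj (y -V (N *V t)) (λ i →
        trans (·-distrib-- B y (N *V t) i)
        (trans (cong₂ ℤ._-_ (By≈NBt i) (·-scale B N t i)) (ℤP.+-inverseʳ (N ℤ.* (B · t) i)))) j)

    -- dual x, for x the integer pairings of u with the columns of B, has the same pairings with 𝓕
    -- as u; both lie in ℚ𝓕, so their difference is orthogonal to itself.
    dual-surjective : ∀ u → InFlowSharp Σc u → ∃[ x ] (∀ i → dual x i - u i ≡ 0ℚ)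
    dual-surjective u (u-span , u-integral) = x , sum-squares≡0 e ⟨e,e⟩≡0
      where
      x : ℤ^ m
      x j = proj₁ (u-integral (λ i → B i j) (column-flow j))
      ⟨u,Bⱼ⟩≡xⱼ : ∀ j → ⟨ u , embed (λ i → B i j) ⟩ ≡ toℚ (x j)
      ⟨u,Bⱼ⟩≡xⱼ j = proj₂ (u-integral (λ i → B i j) (column-flow j))
      e : ℚ^ n
      e = dual x -Q u
      ⟨u,B·t⟩ : ∀ t → ⟨ u , embed (B · t) ⟩ ≡ toℚ (dot x t)
      ⟨u,B·t⟩ t = begin
        ⟨ u , embed (B · t) ⟩                              ≡⟨ ⟨⟩-· u B t ⟩
        sumℚ (λ j → toℚ (t j) * ⟨ u , embed (λ i → B i j) ⟩) ≡⟨ sumℚ-cong (λ j → cong (toℚ (t j) *_) (⟨u,Bⱼ⟩≡xⱼ j)) ⟩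
        ⟨ embed t , embed x ⟩                              ≡⟨ toℚ-dot t x ⟨
        toℚ (dot t x)                                      ≡⟨ cong toℚ (dot-comm t x) ⟩
        toℚ (dot x t)                                      ∎
        where open ≡-Reasoning
      e⊥flows : ∀ w → InFlow Σc w → ⟨ e , embed w ⟩ ≡ 0ℚ
      e⊥flows w w-flow with B-spans w w-flow
      ... | t , w≈Bt = begin
        ⟨ e , embed w ⟩                                   ≡⟨ ⟨⟩-comm e (embed w) ⟩
        ⟨ embed w , e ⟩                                   ≡⟨ ⟨⟩-distrib-- (embed w) (dual x) u ⟩
        ⟨ embed w , dual x ⟩ - ⟨ embed w , u ⟩            ≡⟨ cong₂ _-_ (⟨⟩-comm (embed w) (dual x)) (⟨⟩-comm (embed w) u) ⟩
        ⟨ dual x , embed w ⟩ - ⟨ u , embed w ⟩            ≡⟨ cong₂ _-_ (⟨⟩-congʳ (dual x) w≈Bt′) (⟨⟩-congʳ u w≈Bt′) ⟩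
        ⟨ dual x , embed (B · t) ⟩ - ⟨ u , embed (B · t) ⟩ ≡⟨ cong₂ _-_ (⟨dual,B·t⟩ x t) (⟨u,B·t⟩ t) ⟩
        toℚ (dot x t) - toℚ (dot x t)                     ≡⟨ ℚP.+-inverseʳ (toℚ (dot x t)) ⟩
        0ℚ                                                ∎
        where
        open ≡-Reasoning
        w≈Bt′ : ∀ i → toℚ (w i) ≡ toℚ ((B · t) i)
        w≈Bt′ i = cong toℚ (w≈Bt i)
      ⟨e,e⟩≡0 : ⟨ e , e ⟩ ≡ 0ℚ
      ⟨e,e⟩≡0 = trans (⟨⟩-distrib-- e (dual x) u)
                  (cong₂ _-_ (orthogonal-to-flows e (dual x) (dual-span x) e⊥flows) (orthogonal-to-flows e u u-span e⊥flows))

    dual-zero : ∀ i → dual zeroV i ≡ 0ℚ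
    dual-zero i = trans (dual-eval zeroV i) (trans (cong (λ u → toℚ u * N⁻¹) (·-zero B (·-zeroV Adj) i)) (ℚP.*-zeroˡ N⁻¹))

    dual-respects-G : ∀ x x′ t → (x -V x′) ≈V G · t → ∀ i → dual x i - dual x′ i ≡ toℚ ((B · t) i)
    dual-respects-G x x′ t x-x′≈Gt i = trans (sym (dual-- x x′ i)) (trans (dual-cong x-x′≈Gt i) (dual-G t i))

    dual-additive : ∀ {z} x x′ → z ≈V x +V x′ → ∀ i → dual z i - (dual x i + dual x′ i) ≡ 0ℚ
    dual-additive {z} x x′ z≈x+x′ i = begin
      dual z i - (dual x i + dual x′ i)           ≡⟨ cong (_- (dual x i + dual x′ i)) (trans (dual-cong z≈x+x′ i) (dual-+ x x′ i)) ⟩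
      (dual x i + dual x′ i) - (dual x i + dual x′ i) ≡⟨ ℚP.+-inverseʳ (dual x i + dual x′ i) ⟩
      0ℚ                                          ∎
      where open ≡-Reasoning

module CocriticalGroup {d : ℕ} (Σc : CWChainComplex d) (Ω : Acyclization Σc) where

  open Acyclization Ω
  open FlowLattice Σc
  open IntegerMatrix using (·-zeroV)

  acyclizationBasis : FlowBasis
  acyclizationBasis = record { m = m ; B = ∂top ; B-flow = ∂∂top ; B-inj = H-top ; B-spans = H-d }

  open Dual acyclizationBasis

  cocritical≅flowDiscriminant : Cocritical ≅ FlowDiscriminant Σc
  cocritical≅flowDiscriminant = record { iso = dualHom ; inj = dual-inj ; surj = dual-surj }
    where
    dualHom : Hom Cocritical (FlowDiscriminant Σc)
    dualHom = record
      { fun  = λ (x , _) → dual x , dual-sharp x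
      ; cong = λ (x , _) (x′ , _) (t , x-x′≈Gt) → B · t , B-flow t , dual-respects-G x x′ t x-x′≈Gt
      ; hom  = λ (x , _) (x′ , _) _ z≡x+x′ → zeroV , ·-zeroV ∂ , dual-additive x x′ (λ i → cong (λ v → v i) z≡x+x′) }
    dual-inj : Injective dualHom
    dual-inj (x , _) (x′ , _) (f , f-flow , dual≡f) = dual-kernel x x′ f f-flow dual≡f
    dual-surj : Surjective dualHom
    dual-surj (u , u-sharp) = let (x , dual≡u) = dual-surjective u u-sharp in (x , _) , zeroV , ·-zeroV ∂ , dual≡u

module TorsionCycles where

  open import Data.Integer as ℤ using (ℤ)
  open import Data.Unit using (tt)
  open IntegerMatrix using (·-scale; ·-congʳ)
  open SquareMatrix using (i*j≡0⇒j≡0)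

  Torsion : ∀ {d} (Σc : CWChainComplex d) → ℤ^ (CWChainComplex.rank Σc d) → Set
  Torsion Σc x = ∃[ N ] (N ≢ ℤ.0ℤ × Boundary Σc (N *V x))

  torsion⇒cycle : ∀ {d} (Σc : CWChainComplex d) {x} → Torsion Σc x → Cycle Σc d x
  torsion⇒cycle {zero}  Σc _ = tt
  torsion⇒cycle {suc d} Σc {x} (N , N≢0 , y , Nx≈∂y) i =
    i*j≡0⇒j≡0 N≢0 (trans (sym (·-scale (∂ d) N x i)) (trans (·-congʳ (∂ d) Nx≈∂y i) (∂∂ d y i)))
    where open CWChainComplex Σc

module CutFlowSequence {d : ℕ} (Σc : CWChainComplex d) where

  open import Data.Integer as ℤ using (ℤ; _+_; _-_; _*_)
  import Data.Integer.Properties as ℤP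
  import Data.Rational as ℚ
  import Data.Rational.Properties as ℚP
  open import Data.Integer.Tactic.RingSolver using (solve-∀)
  open import Data.Unit using (tt)
  open IntegerMatrix
  open Blocks
  open InvertibleMatrix using (Invertible-ᵀ; M⁻¹·M·x≈x; M·M⁻¹·x≈x)
  open DiagonalForm
  open SquareMatrix using (i*j≡0⇒j≡0; CommonMultiple; commonMultiple)
  open FlowLattice Σc
  open RationalVector using (dot-self≡0)
  open DiagonalFormAction (diagonalForm ∂) renaming (m to ℓ)

  r : ℕ
  r = CWChainComplex.rank Σc d

  -- The rows of D are indexed by k + r′ and its columns by k + ℓ, sharing the k pivot positions.
  module ToColumns = KeepUpper k r′ ℓ
  module ToRows    = KeepUpper k ℓ r′

  Qᵀ·Q⁻¹ᵀ·z≈z : ∀ z → Q.M ᵀ · (Q.M⁻¹ ᵀ · z) ≈V z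
  Qᵀ·Q⁻¹ᵀ·z≈z = M·M⁻¹·x≈x (Invertible-ᵀ Q)

  Q⁻¹ᵀ·Qᵀ·z≈z : ∀ z → Q.M⁻¹ ᵀ · (Q.M ᵀ · z) ≈V z
  Q⁻¹ᵀ·Qᵀ·z≈z = M⁻¹·M·x≈x (Invertible-ᵀ Q)

  flowColumns : Mat n ℓ
  flowColumns i l = Q.M i (k ↑ʳ l)

  flowColumns·x : ∀ x → flowColumns · x ≈V Q.M · embedLower {k} x
  flowColumns·x x i = sym (begin
    sumℤ (λ j → Q.M i j * embedLower {k} x j)                                      ≡⟨ sumℤ-split k (λ j → Q.M i j * embedLower {k} x j) ⟩
    sumℤ (λ a → Q.M i (a ↑ˡ ℓ) * embedLower {k} x (a ↑ˡ ℓ)) + sumℤ (λ l → Q.M i (k ↑ʳ l) * embedLower {k} x (k ↑ʳ l))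
      ≡⟨ cong₂ _+_ (sumℤ-zero (λ a → trans (cong (Q.M i (a ↑ˡ ℓ) *_) (embedLower-upper {k} x a)) (ℤP.*-zeroʳ (Q.M i (a ↑ˡ ℓ)))))
                   (sumℤ-cong (λ l → cong (Q.M i (k ↑ʳ l) *_) (embedLower-lower {k} x l))) ⟩
    ℤ.0ℤ + (flowColumns · x) i                                                     ≡⟨ ℤP.+-identityˡ _ ⟩
    (flowColumns · x) i                                                            ∎)
    where open ≡-Reasoning

  flow-upper≡0 : ∀ v → InFlow Σc v → ∀ a → (Q.M⁻¹ · v) (a ↑ˡ ℓ) ≡ ℤ.0ℤ
  flow-upper≡0 v v-flow a = i*j≡0⇒j≡0 (δ≢0 a) (begin
    δ a * (Q.M⁻¹ · v) (a ↑ˡ ℓ)          ≡⟨ diagonal-·-upper δ (Q.M⁻¹ · v) a ⟨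
    (D · (Q.M⁻¹ · v)) (a ↑ˡ r′)         ≡⟨ P·A·Q·y≈D·y (Q.M⁻¹ · v) (a ↑ˡ r′) ⟨
    (P.M · (∂ · (Q.M · (Q.M⁻¹ · v)))) (a ↑ˡ r′) ≡⟨ ·-zero P.M (λ i → trans (·-congʳ ∂ (M·M⁻¹·x≈x Q v) i) (v-flow i)) (a ↑ˡ r′) ⟩
    ℤ.0ℤ                                ∎)
    where open ≡-Reasoning

  D·embedLower≗0 : ∀ x → IsZeroV (D · embedLower {k} x)
  D·embedLower≗0 x = ≈V-by-blocks
    (λ a → trans (diagonal-·-upper δ (embedLower {k} x) a) (trans (cong (δ a *_) (embedLower-upper {k} x a)) (ℤP.*-zeroʳ (δ a))))
    (λ l → diagonal-·-lower δ (embedLower {k} x) l)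

  diagonalFlowBasis : FlowBasis
  diagonalFlowBasis = record { m = ℓ ; B = flowColumns ; B-flow = columns-flow ; B-inj = columns-inj ; B-spans = columns-span }
    where
    columns-flow : ∀ x → InFlow Σc (flowColumns · x)
    columns-flow x = ≈V-trans (·-congʳ ∂ (flowColumns·x x))
                       (≈V-trans (A·Q·y≈P⁻¹·D·y (embedLower {k} x)) (·-zero P.M⁻¹ (D·embedLower≗0 x)))
    columns-inj : ∀ x → IsZeroV (flowColumns · x) → IsZeroV x
    columns-inj x Bx≗0 l = begin
      x l                                           ≡⟨ embedLower-lower {k} x l ⟨
      embedLower {k} x (k ↑ʳ l)                     ≡⟨ M⁻¹·M·x≈x Q (embedLower {k} x) (k ↑ʳ l) ⟨
      (Q.M⁻¹ · (Q.M · embedLower {k} x)) (k ↑ʳ l)   ≡⟨ ·-zero Q.M⁻¹ (≈V-trans (≈V-sym (flowColumns·x x)) Bx≗0) (k ↑ʳ l) ⟩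
      ℤ.0ℤ                                          ∎
      where open ≡-Reasoning
    columns-span : ∀ v → InFlow Σc v → ∃[ x ] (v ≈V flowColumns · x)
    columns-span v v-flow = x , ≈V-trans (≈V-sym (M·M⁻¹·x≈x Q v)) (≈V-trans (·-congʳ Q.M Q⁻¹v≈x) (≈V-sym (flowColumns·x x)))
      where
      x : ℤ^ ℓ
      x l = (Q.M⁻¹ · v) (k ↑ʳ l)
      Q⁻¹v≈x : Q.M⁻¹ · v ≈V embedLower {k} x
      Q⁻¹v≈x = ≈V-by-blocks (λ a → trans (flow-upper≡0 v v-flow a) (sym (embedLower-upper {k} x a)))
                            (λ l → sym (embedLower-lower {k} x l))

  open Dual diagonalFlowBasis using (G; G·x≈Bᵀ·B·x; B-flow; B-spans; dual; dual-sharp; dual-cong; dual-G; dual-zero; dual-respects-G; dual-additive; dual-kernel; dual-surjective)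

  P·∂≈D·Q⁻¹ : P.M ⊙ ∂ ≈M D ⊙ Q.M⁻¹
  P·∂≈D·Q⁻¹ =
    ≈M-trans (≈M-sym (⊙-I (P.M ⊙ ∂)))
    (≈M-trans (⊙-congˡ (P.M ⊙ ∂) (≈M-sym Q.M⊙M⁻¹))
    (≈M-trans (≈M-sym (⊙-assoc (P.M ⊙ ∂) Q.M Q.M⁻¹))
    (⊙-congʳ Q.M⁻¹ PAQ≈D)))

  ∂ᵀ·Pᵀ·t : ∀ t → ∂ ᵀ · (P.M ᵀ · t) ≈V Q.M⁻¹ ᵀ · (D ᵀ · t)
  ∂ᵀ·Pᵀ·t t =
    ≈V-trans (≈V-sym (⊙-· (∂ ᵀ) (P.M ᵀ) t))
    (≈V-trans (·-cong (≈M-sym (ᵀ-⊙ P.M ∂)) (λ _ → refl))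
    (≈V-trans (·-cong (λ i j → P·∂≈D·Q⁻¹ j i) (λ _ → refl))
    (≈V-trans (·-cong (ᵀ-⊙ D Q.M⁻¹) (λ _ → refl))
    (⊙-· (Q.M⁻¹ ᵀ) (D ᵀ) t))))

  ∂ᵀ·y : ∀ y → ∂ ᵀ · y ≈V Q.M⁻¹ ᵀ · (D ᵀ · (P.M⁻¹ ᵀ · y))
  ∂ᵀ·y y = ≈V-trans (·-congʳ (∂ ᵀ) (≈V-sym (M·M⁻¹·x≈x (Invertible-ᵀ P) y))) (∂ᵀ·Pᵀ·t (P.M⁻¹ ᵀ · y))

  cuts⊥flows : ∀ y → IsZeroV (flowColumns ᵀ · (∂ ᵀ · y))
  cuts⊥flows y l = trans (·-congʳ (Q.M ᵀ) (∂ᵀ·y y) (k ↑ʳ l))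
                     (trans (Qᵀ·Q⁻¹ᵀ·z≈z _ (k ↑ʳ l)) (diagonalᵀ-·-lower δ (P.M⁻¹ ᵀ · y) l))

  infix 4 _≈CF_

  _≈CF_ : ℤ^ n → ℤ^ n → Set
  u ≈CF v = ∃[ c ] ∃[ f ] (InCut Σc c × InFlow Σc f × (∀ i → (u -V v) i ≡ (c +V f) i))

  Bᵀ-cut+flow : ∀ {u v c w} t → (∀ i → (u -V v) i ≡ (c +V w) i) → InCut Σc c → w ≈V flowColumns · t →
                (flowColumns ᵀ · u) -V (flowColumns ᵀ · v) ≈V G · t
  Bᵀ-cut+flow {u} {v} {c} {w} t u-v≈c+w (y , c≈∂ᵀy) w≈Bt l = begin
    (Bᵀ · u) l - (Bᵀ · v) l          ≡⟨ ·-distrib-- Bᵀ u v l ⟨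
    (Bᵀ · (u -V v)) l                ≡⟨ ·-congʳ Bᵀ u-v≈c+w l ⟩
    (Bᵀ · (c +V w)) l                ≡⟨ ·-distrib-+ Bᵀ c w l ⟩
    (Bᵀ · c) l + (Bᵀ · w) l          ≡⟨ cong₂ _+_ (trans (·-congʳ Bᵀ c≈∂ᵀy l) (cuts⊥flows y l)) (·-congʳ Bᵀ w≈Bt l) ⟩
    ℤ.0ℤ + (Bᵀ · (flowColumns · t)) l ≡⟨ ℤP.+-identityˡ _ ⟩
    (Bᵀ · (flowColumns · t)) l       ≡⟨ G·x≈Bᵀ·B·x t l ⟨
    (G · t) l                        ∎
    where
    open ≡-Reasoning
    Bᵀ = flowColumns ᵀ

  ι : ℤ^ r → ℤ^ n
  ι x = Q.M⁻¹ ᵀ · ToColumns.T (P.M · x)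

  ι-cong : ∀ {x x′} → x ≈V x′ → ι x ≈V ι x′
  ι-cong x≈x′ = ·-congʳ (Q.M⁻¹ ᵀ) (ToColumns.T-cong (·-congʳ P.M x≈x′))

  ι-+ : ∀ x x′ → ι (x +V x′) ≈V ι x +V ι x′
  ι-+ x x′ = ≈V-trans (·-congʳ (Q.M⁻¹ ᵀ) (≈V-trans (ToColumns.T-cong (·-distrib-+ P.M x x′)) (ToColumns.T-+ _ _)))
                      (·-distrib-+ (Q.M⁻¹ ᵀ) _ _)

  ι-- : ∀ x x′ → ι (x -V x′) ≈V ι x -V ι x′
  ι-- x x′ = ≈V-trans (·-congʳ (Q.M⁻¹ ᵀ) (≈V-trans (ToColumns.T-cong (·-distrib-- P.M x x′)) (ToColumns.T-- _ _)))
                      (·-distrib-- (Q.M⁻¹ ᵀ) _ _)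

  Bᵀ·ι≗0 : ∀ x → IsZeroV (flowColumns ᵀ · ι x)
  Bᵀ·ι≗0 x l = trans (Qᵀ·Q⁻¹ᵀ·z≈z _ (k ↑ʳ l)) (ToColumns.T-lower (P.M · x) l)

  T·D≈Dᵀ·T : ∀ z → ToColumns.T (D · z) ≈V D ᵀ · ToRows.T z
  T·D≈Dᵀ·T z = ≈V-by-blocks
    (λ a → trans (ToColumns.T-upper (D · z) a) (trans (diagonal-·-upper δ z a)
             (sym (trans (diagonalᵀ-·-upper δ (ToRows.T z) a) (cong (δ a *_) (ToRows.T-upper z a))))))
    (λ l → trans (ToColumns.T-lower (D · z) l) (sym (diagonalᵀ-·-lower δ (ToRows.T z) l)))

  ι-boundary : ∀ y → ι (∂ · y) ≈V ∂ ᵀ · (P.M ᵀ · ToRows.T (Q.M⁻¹ · y))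
  ι-boundary y =
    ≈V-trans (·-congʳ (Q.M⁻¹ ᵀ) (ToColumns.T-cong (P·A·y≈D·Q⁻¹·y y)))
    (≈V-trans (·-congʳ (Q.M⁻¹ ᵀ) (T·D≈Dᵀ·T (Q.M⁻¹ · y)))
    (≈V-sym (∂ᵀ·Pᵀ·t _)))

  zero-cut : InCut Σc zeroV
  zero-cut = zeroV , λ i → sym (·-zeroV (∂ ᵀ) i)

  ι-respects-boundaries : ∀ x x′ → Boundary Σc (x -V x′) → ι x ≈CF ι x′
  ι-respects-boundaries x x′ (y , x-x′≈∂y) =
    ι x -V ι x′ , zeroV , (P.M ᵀ · ToRows.T (Q.M⁻¹ · y) , ιx-ιx′≈cut) , ·-zeroV ∂ , (λ i → sym (ℤP.+-identityʳ _))
    where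
    ιx-ιx′≈cut : ι x -V ι x′ ≈V ∂ ᵀ · (P.M ᵀ · ToRows.T (Q.M⁻¹ · y))
    ιx-ιx′≈cut = ≈V-trans (≈V-sym (ι-- x x′)) (≈V-trans (ι-cong x-x′≈∂y) (ι-boundary y))

  ι-additive : ∀ {x″} x x′ → x″ ≡ x +V x′ → ι x″ ≈CF ι x +V ι x′
  ι-additive x x′ refl = zeroV , zeroV , zero-cut , ·-zeroV ∂ , λ i →
    trans (cong (_- (ι x i + ι x′ i)) (ι-+ x x′ i)) (ℤP.+-inverseʳ (ι x i + ι x′ i))

  Torsion : ℤ^ r → Set
  Torsion = TorsionCycles.Torsion Σc

  torsion-lower≡0 : ∀ {x} → Torsion x → ∀ l → (P.M · x) (k ↑ʳ l) ≡ ℤ.0ℤ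
  torsion-lower≡0 {x} (N , N≢0 , y , Nx≈∂y) l = i*j≡0⇒j≡0 N≢0 (begin
    N * (P.M · x) (k ↑ʳ l)       ≡⟨ ·-scale P.M N x (k ↑ʳ l) ⟨
    (P.M · (N *V x)) (k ↑ʳ l)    ≡⟨ ·-congʳ P.M Nx≈∂y (k ↑ʳ l) ⟩
    (P.M · (∂ · y)) (k ↑ʳ l)     ≡⟨ P·A·y≈D·Q⁻¹·y y (k ↑ʳ l) ⟩
    (D · (Q.M⁻¹ · y)) (k ↑ʳ l)   ≡⟨ diagonal-·-lower δ (Q.M⁻¹ · y) l ⟩
    ℤ.0ℤ                         ∎)
    where open ≡-Reasoning

  boundary-of-diagonal : ∀ z t → P.M · z ≈V D · t → Boundary Σc z
  boundary-of-diagonal z t Pz≈Dt = Q.M · t , λ i →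
    trans (sym (M⁻¹·M·x≈x P z i)) (trans (·-congʳ P.M⁻¹ Pz≈Dt i) (sym (A·Q·y≈P⁻¹·D·y t i)))

  -- Q⁻¹ᵀ(ℤ^k ⊕ 0) is orthogonal to the flows, which are Q(0 ⊕ ℤ^ℓ); a flow in it has ⟨w,w⟩ = 0.
  flow-in-upper≗0 : ∀ w s → InFlow Σc w → w ≈V Q.M⁻¹ ᵀ · s → (∀ l → s (k ↑ʳ l) ≡ ℤ.0ℤ) → IsZeroV w
  flow-in-upper≗0 w s w-flow w≈Q⁻¹ᵀs s-lower≡0 = dot-self≡0 w (begin
    dot w w                                   ≡⟨ dot-congˡ w w≈Q⁻¹ᵀs ⟩
    dot (Q.M⁻¹ ᵀ · s) w                       ≡⟨ dot-adjoint Q.M⁻¹ s w ⟩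
    dot s (Q.M⁻¹ · w)                         ≡⟨ dot-split k s (Q.M⁻¹ · w) ⟩
    sumℤ (λ a → s (a ↑ˡ ℓ) * (Q.M⁻¹ · w) (a ↑ˡ ℓ)) + sumℤ (λ l → s (k ↑ʳ l) * (Q.M⁻¹ · w) (k ↑ʳ l))
      ≡⟨ cong₂ _+_ (sumℤ-zero (λ a → trans (cong (s (a ↑ˡ ℓ) *_) (flow-upper≡0 w w-flow a)) (ℤP.*-zeroʳ (s (a ↑ˡ ℓ)))))
                   (sumℤ-zero (λ l → trans (cong (_* (Q.M⁻¹ · w) (k ↑ʳ l)) (s-lower≡0 l)) (ℤP.*-zeroˡ ((Q.M⁻¹ · w) (k ↑ʳ l))))) ⟩
    ℤ.0ℤ                                      ∎)
    where open ≡-Reasoning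

  ι-injective : ∀ x x′ → Torsion x → Torsion x′ → ι x ≈CF ι x′ → Boundary Σc (x -V x′)
  ι-injective x x′ x-torsion x′-torsion (c , w , (y , c≈∂ᵀy) , w-flow , ιx-ιx′≈c+w) = boundary-of-diagonal z t Pz≈Dt
    where
    z = x -V x′
    u = P.M⁻¹ ᵀ · y
    s = ToColumns.T (P.M · z) -V (D ᵀ · u)
    w≈Q⁻¹ᵀs : w ≈V Q.M⁻¹ ᵀ · s
    w≈Q⁻¹ᵀs i = begin
      w i                                   ≡⟨ w≡[c+w]-c (c i) (w i) ⟩
      (c i + w i) - c i                     ≡⟨ cong (_- c i) (ιx-ιx′≈c+w i) ⟨
      (ι x i - ι x′ i) - c i                ≡⟨ cong₂ _-_ (sym (ι-- x x′ i)) (trans (c≈∂ᵀy i) (∂ᵀ·y y i)) ⟩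
      ι z i - (Q.M⁻¹ ᵀ · (D ᵀ · u)) i       ≡⟨ ·-distrib-- (Q.M⁻¹ ᵀ) _ _ i ⟨
      (Q.M⁻¹ ᵀ · s) i                       ∎
      where
      open ≡-Reasoning
      w≡[c+w]-c : ∀ c w → w ≡ (c + w) - c
      w≡[c+w]-c = solve-∀
    s≗0 : IsZeroV s
    s≗0 = ≈V-trans (≈V-sym (Qᵀ·Q⁻¹ᵀ·z≈z s)) (≈V-trans (·-congʳ (Q.M ᵀ) (≈V-sym w≈Q⁻¹ᵀs))
            (·-zero (Q.M ᵀ) (flow-in-upper≗0 w s w-flow w≈Q⁻¹ᵀs
              (λ l → cong₂ _-_ (ToColumns.T-lower (P.M · z) l) (diagonalᵀ-·-lower δ u l)))))
    t = ToColumns.T u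
    Pz≈Dt : P.M · z ≈V D · t
    Pz≈Dt = ≈V-by-blocks
      (λ a → begin
        (P.M · z) (a ↑ˡ r′)                  ≡⟨ ToColumns.T-upper (P.M · z) a ⟨
        ToColumns.T (P.M · z) (a ↑ˡ ℓ)       ≡⟨ ℤP.i-j≡0⇒i≡j _ _ (s≗0 (a ↑ˡ ℓ)) ⟩
        (D ᵀ · u) (a ↑ˡ ℓ)                   ≡⟨ diagonalᵀ-·-upper δ u a ⟩
        δ a * u (a ↑ˡ r′)                    ≡⟨ cong (δ a *_) (ToColumns.T-upper u a) ⟨
        δ a * t (a ↑ˡ ℓ)                     ≡⟨ diagonal-·-upper δ t a ⟨
        (D · t) (a ↑ˡ r′)                    ∎)
      (λ l → begin
        (P.M · z) (k ↑ʳ l)                   ≡⟨ ·-distrib-- P.M x x′ (k ↑ʳ l) ⟩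
        (P.M · x) (k ↑ʳ l) - (P.M · x′) (k ↑ʳ l) ≡⟨ cong₂ _-_ (torsion-lower≡0 x-torsion l) (torsion-lower≡0 x′-torsion l) ⟩
        ℤ.0ℤ                                 ≡⟨ diagonal-·-lower δ t l ⟨
        (D · t) (k ↑ʳ l)                     ∎)
      where open ≡-Reasoning

  infix 4 _≈FD_

  _≈FD_ : ℚ^ n → ℚ^ n → Set
  u ≈FD v = ∃[ f ] (InFlow Σc f × (∀ i → (u -Q v) i ≡ toℚ (f i)))

  π : ℤ^ n → ℚ^ n
  π b = dual (flowColumns ᵀ · b)

  π-respects-cut+flow : ∀ b b′ → b ≈CF b′ → π b ≈FD π b′
  π-respects-cut+flow b b′ (c , w , c-cut , w-flow , b-b′≈c+w) =
    let (t , w≈Bt) = B-spans w w-flow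
    in flowColumns · t , B-flow t , dual-respects-G _ _ t (Bᵀ-cut+flow t b-b′≈c+w c-cut w≈Bt)

  π-additive : ∀ {b″} b b′ → b″ ≡ b +V b′ → π b″ ≈FD π b +Q π b′
  π-additive b b′ refl = zeroV , ·-zeroV ∂ , dual-additive _ _ (·-distrib-+ (flowColumns ᵀ) b b′)

  π-surjective : ∀ u → InFlowSharp Σc u → ∃[ b ] (π b ≈FD u)
  π-surjective u u-sharp =
    let (x , dual≡u) = dual-surjective u u-sharp
    in Q.M⁻¹ ᵀ · embedLower {k} x , zeroV , ·-zeroV ∂ , λ i → trans (cong (ℚ._- u i) (dual-cong (Bᵀ·Q⁻¹ᵀ·embedLower x) i)) (dual≡u i)
    where
    Bᵀ·Q⁻¹ᵀ·embedLower : ∀ x → flowColumns ᵀ · (Q.M⁻¹ ᵀ · embedLower {k} x) ≈V x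
    Bᵀ·Q⁻¹ᵀ·embedLower x l = trans (Qᵀ·Q⁻¹ᵀ·z≈z (embedLower {k} x) (k ↑ʳ l)) (embedLower-lower {k} x l)

  Bᵀ·b-from-ι : ∀ a b {c w} t → (∀ i → (ι a -V b) i ≡ (c +V w) i) → InCut Σc c → w ≈V flowColumns · t →
                flowColumns ᵀ · b ≈V G · (ℤ.-1ℤ *V t)
  Bᵀ·b-from-ι a b t ιa-b≈c+w c-cut w≈Bt l = begin
    (Bᵀ · b) l                                   ≡⟨ negate-twice ((Bᵀ · ι a) l) ((Bᵀ · b) l) ⟩
    (Bᵀ · ι a) l - ((Bᵀ · ι a) l - (Bᵀ · b) l)   ≡⟨ cong₂ _-_ (Bᵀ·ι≗0 a l) (Bᵀ-cut+flow t ιa-b≈c+w c-cut w≈Bt l) ⟩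
    ℤ.0ℤ - (G · t) l                             ≡⟨ ℤP.+-identityˡ _ ⟩
    ℤ.- (G · t) l                                ≡⟨ ℤP.-1*i≡-i ((G · t) l) ⟨
    ℤ.-1ℤ * (G · t) l                            ≡⟨ ·-scale G ℤ.-1ℤ t l ⟨
    (G · (ℤ.-1ℤ *V t)) l                         ∎
    where
    open ≡-Reasoning
    Bᵀ = flowColumns ᵀ
    negate-twice : ∀ x y → y ≡ x - (x - y)
    negate-twice = solve-∀

  π∘ι≈0 : ∀ a b → ι a ≈CF b → π b ≈FD zeroQ
  π∘ι≈0 a b (c , w , c-cut , w-flow , ιa-b≈c+w) =
    let (t , w≈Bt) = B-spans w w-flow
    in flowColumns · (ℤ.-1ℤ *V t) , B-flow (ℤ.-1ℤ *V t) ,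
       λ i → trans (ℚP.+-identityʳ _) (trans (dual-cong (Bᵀ·b-from-ι a b t ιa-b≈c+w c-cut w≈Bt) i) (dual-G (ℤ.-1ℤ *V t) i))

  upper-torsion : ∀ u → Torsion (P.M⁻¹ · ToRows.T u)
  upper-torsion u = C.N , C.N≢0 , Q.M · t , λ i → begin
    C.N * (P.M⁻¹ · ToRows.T u) i       ≡⟨ ·-scale P.M⁻¹ C.N (ToRows.T u) i ⟨
    (P.M⁻¹ · (C.N *V ToRows.T u)) i    ≡⟨ ·-congʳ P.M⁻¹ D·t≈N·Tu i ⟨
    (P.M⁻¹ · (D · t)) i                ≡⟨ A·Q·y≈P⁻¹·D·y t i ⟨
    (∂ · (Q.M · t)) i                  ∎
    where
    open ≡-Reasoning
    module C = CommonMultiple (commonMultiple δ δ≢0)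
    t = diagonal {k} {ℓ} {ℓ} C.cofactor · u
    D·t≈N·Tu : D · t ≈V C.N *V ToRows.T u
    D·t≈N·Tu = ≈V-by-blocks
      (λ a → begin
        (D · t) (a ↑ˡ r′)                      ≡⟨ diagonal-·-upper δ t a ⟩
        δ a * t (a ↑ˡ ℓ)                       ≡⟨ cong (δ a *_) (diagonal-·-upper C.cofactor u a) ⟩
        δ a * (C.cofactor a * u (a ↑ˡ ℓ))      ≡⟨ ℤP.*-assoc (δ a) _ _ ⟨
        δ a * C.cofactor a * u (a ↑ˡ ℓ)        ≡⟨ cong (_* u (a ↑ˡ ℓ)) (trans (ℤP.*-comm (δ a) _) (C.cofactor* a)) ⟩
        C.N * u (a ↑ˡ ℓ)                       ≡⟨ cong (C.N *_) (ToRows.T-upper u a) ⟨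
        C.N * ToRows.T u (a ↑ˡ r′)             ∎)
      (λ l → trans (diagonal-·-lower δ t l) (sym (trans (cong (C.N *_) (ToRows.T-lower u l)) (ℤP.*-zeroʳ C.N))))

  ι-upper : ∀ s → (∀ l → s (k ↑ʳ l) ≡ ℤ.0ℤ) → ι (P.M⁻¹ · ToRows.T s) ≈V Q.M⁻¹ ᵀ · s
  ι-upper s s-lower≡0 = ·-congʳ (Q.M⁻¹ ᵀ) (≈V-trans (ToColumns.T-cong (M·M⁻¹·x≈x P (ToRows.T s))) TTs≈s)
    where
    TTs≈s : ToColumns.T (ToRows.T s) ≈V s
    TTs≈s = ≈V-by-blocks (λ a → trans (ToColumns.T-upper _ a) (ToRows.T-upper s a))
                         (λ l → trans (ToColumns.T-lower _ l) (sym (s-lower≡0 l)))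

  kernel-preimage : ∀ b t → flowColumns ᵀ · b ≈V G · t → ∃[ a ] ((Cycle Σc d a × Torsion a) × ι a ≈CF b)
  kernel-preimage b t Bᵀb≈Gt = a , (TorsionCycles.torsion⇒cycle Σc (upper-torsion s) , upper-torsion s) ,
                       zeroV , flowColumns · (ℤ.-1ℤ *V t) , zero-cut , B-flow (ℤ.-1ℤ *V t) , ιa-b≈-Bt
    where
    b₁ = b -V (flowColumns · t)
    s = Q.M ᵀ · b₁
    s-lower≡0 : ∀ l → s (k ↑ʳ l) ≡ ℤ.0ℤ
    s-lower≡0 l = begin
      (flowColumns ᵀ · b₁) l                                       ≡⟨ ·-distrib-- (flowColumns ᵀ) b (flowColumns · t) l ⟩
      (flowColumns ᵀ · b) l - (flowColumns ᵀ · (flowColumns · t)) l ≡⟨ cong₂ _-_ (Bᵀb≈Gt l) (sym (G·x≈Bᵀ·B·x t l)) ⟩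
      (G · t) l - (G · t) l                                        ≡⟨ ℤP.+-inverseʳ ((G · t) l) ⟩
      ℤ.0ℤ                                                          ∎
      where open ≡-Reasoning
    a = P.M⁻¹ · ToRows.T s
    ιa≈b₁ : ι a ≈V b₁
    ιa≈b₁ = ≈V-trans (ι-upper s s-lower≡0) (Q⁻¹ᵀ·Qᵀ·z≈z b₁)
    ιa-b≈-Bt : ∀ i → (ι a -V b) i ≡ (zeroV +V (flowColumns · (ℤ.-1ℤ *V t))) i
    ιa-b≈-Bt i = begin
      ι a i - b i                          ≡⟨ cong (_- b i) (ιa≈b₁ i) ⟩
      (b i - (flowColumns · t) i) - b i     ≡⟨ cancel (b i) ((flowColumns · t) i) ⟩
      ℤ.0ℤ + ℤ.-1ℤ * (flowColumns · t) i    ≡⟨ cong (ℤ.0ℤ +_) (·-scale flowColumns ℤ.-1ℤ t i) ⟨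
      ℤ.0ℤ + (flowColumns · (ℤ.-1ℤ *V t)) i ∎
      where
      open ≡-Reasoning
      cancel : ∀ x y → (x - y) - x ≡ ℤ.0ℤ + ℤ.-1ℤ * y
      cancel = solve-∀

  π-kernel : ∀ b → π b ≈FD zeroQ → ∃[ a ] ((Cycle Σc d a × Torsion a) × ι a ≈CF b)
  π-kernel b (w , w-flow , πb≈w) =
    let (t , Bᵀb-0≈Gt) = dual-kernel (flowColumns ᵀ · b) zeroV w w-flow
                           (λ i → trans (cong (λ q → dual (flowColumns ᵀ · b) i ℚ.- q) (dual-zero i)) (πb≈w i))
    in kernel-preimage b t (λ l → trans (sym (ℤP.+-identityʳ _)) (Bᵀb-0≈Gt l))

  cutFlowSequence : ShortExact (TorH Σc) (CutFlowQuot Σc) (FlowDiscriminant Σc)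
  cutFlowSequence = record
    { f = ιHom ; g = πHom
    ; f-inj = λ (x , _ , x-torsion) (x′ , _ , x′-torsion) → ι-injective x x′ x-torsion x′-torsion
    ; g-surj = λ (u , u-sharp) → let (b , πb≈u) = π-surjective u u-sharp in (b , tt) , πb≈u
    ; exact = λ (b , _) → (λ πb≈0 → let (a , a-torsion-cycle , ιa≈b) = π-kernel b πb≈0 in (a , a-torsion-cycle) , ιa≈b)
                        , (λ (a , _) → π∘ι≈0 a b) }
    where
    ιHom : Hom (TorH Σc) (CutFlowQuot Σc)
    ιHom = record
      { fun  = λ (x , _) → ι x , tt
      ; cong = λ (x , _) (x′ , _) → ι-respects-boundaries x x′
      ; hom  = λ (x , _) (x′ , _) _ → ι-additive x x′ }
    πHom : Hom (CutFlowQuot Σc) (FlowDiscriminant Σc)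
    πHom = record
      { fun  = λ (b , _) → π b , dual-sharp (flowColumns ᵀ · b)
      ; cong = λ (b , _) (b′ , _) → π-respects-cut+flow b b′
      ; hom  = λ (b , _) (b′ , _) _ → π-additive b b′ }

theorem7p7 : (d : ℕ) (Σc : CWChainComplex d) →
    ShortExact (TorH Σc) (CutFlowQuot Σc) (FlowDiscriminant Σc)
    × ((Ω : Acyclization Σc) → Acyclization.Cocritical Ω ≅ FlowDiscriminant Σc)
theorem7p7 d Σc = CutFlowSequence.cutFlowSequence Σc , CocriticalGroup.cocritical≅flowDiscriminant Σc
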